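{- (a) Let $r\geq 2$ and $\lambda\geq 1$, and let $\Gamma=A_r^{(\lambda)}$. Then $\Gamma$ has a symmetrical Euler cycle $C$ if and only if $r$ is even, and in this case $H(C)=\langle\varphi^2,\varphi\tau\rangle$. (b) Let $r\geq 3$ be odd and $\lambda\geq 1$, and let $\Gamma=B_r^{(\lambda)}$. Then $\Gamma$ has a symmetrical Euler cycle $C$ and $H(C)=\langle\varphi^2,\varphi\tau\rangle$.
   Context: Graphs are finite, loopless, possibly with multiple edges; automorphisms permute $V\cup E$ preserving $V$, $E$ and incidence; $\Gamma^{(\lambda)}$ replaces each edge by $\lambda$ parallel edges. $A_r$ (also written $\mathbf{C}_{2r}+r\mathbf{K}_2^{(2)}$): vertex set $\mathbb{Z}_{2r}$, one edge joining $i$ and $i+1$ for each $i\in\mathbb{Z}_{2r}$, and exactly two edges joining $i$ and $i+r$ for each of the $r$ pairs $\{i,i+r\}$. $B_r$ ($r$ odd; also written $2\mathbf{C}_r+r\mathbf{K}_2^{(2)}$): vertex set $\mathbb{Z}_{2r}$, one edge joining $i$ and $i+2$ for each $i$, and exactly two edges joining each pair $\{i,i+r\}$. A cycle of length $\ell$ is a sequence $C=(e_1,\dots,e_\ell)$ of pairwise distinct edges with vertices $\alpha_0,\dots,\alpha_\ell=\alpha_0$ such that $e_i$ is incident with $\alpha_{i-1},\alpha_i$; Euler cycle: contains every edge. On $E(C)$: $\varphi:e_i\mapsto e_{i+1}$, $\tau:e_i\mapsto e_{\ell+1-i}$, $\varphi\tau:e_i\mapsto e_{\ell-i}$ (indices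 mod $\ell$), $D(C)=\langle\varphi,\tau\rangle$. $H(C)$ is the group of restrictions to $E(C)$ of automorphisms leaving $E(C)$ invariant and restricting to elements of $D(C)$. $C$ is symmetrical if $\varphi^2\in H(C)$. -}

module Defs where

open import Level using (Level; _⊔_) renaming (suc to lsuc)
open import Data.Nat using (ℕ; zero; suc; _+_; _∸_)
open import Data.Nat.DivMod using (_mod_)
open import Data.Fin using (Fin; toℕ; _↑ˡ_; _↑ʳ_)
open import Data.Product using (Σ; _×_; _,_; proj₁; proj₂; ∃; ∃-syntax)
open import Data.Sum using (_⊎_; inj₁; inj₂)
open import Relation.Binary.PropositionalEquality using (_≡_)
open import Function using (_∘_; id)

-- Graphs: finite vertex and edge sets given by types, each edge has an
-- (unordered) pair of end vertices; multiple edges are allowed.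

record Graph : Set₁ where
  field
    V    : Set
    E    : Set
    ends : E → V × V

open Graph public

Inc : (G : Graph) → V G → E G → Set
Inc G v e = (v ≡ proj₁ (ends G e)) ⊎ (v ≡ proj₂ (ends G e))

Joins : (G : Graph) → E G → V G → V G → Set
Joins G e a b = (ends G e ≡ (a , b)) ⊎ (ends G e ≡ (b , a))

_^⁽_⁾ : Graph → ℕ → Graph
G ^⁽ λ′ ⁾ = record { V = V G ; E = E G × Fin λ′ ; ends = λ p → ends G (proj₁ p) }

-- Automorphism: a permutation of V ∪ E preserving V, E and incidence,
-- i.e. a pair of bijections on V and on E preserving incidence.
record Automorphism (G : Graph) : Set where
  field
    fV    : V G → V G
    fV⁻¹  : V G → V G
    fV-l  : ∀ v → fV⁻¹ (fV v) ≡ v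
    fV-r  : ∀ v → fV (fV⁻¹ v) ≡ v
    fE    : E G → E G
    fE⁻¹  : E G → E G
    fE-l  : ∀ e → fE⁻¹ (fE e) ≡ e
    fE-r  : ∀ e → fE (fE⁻¹ e) ≡ e
    inc⇒  : ∀ v e → Inc G v e → Inc G (fV v) (fE e)
    inc⇐  : ∀ v e → Inc G (fV v) (fE e) → Inc G v e

open Automorphism public

addMod : ∀ {n} → Fin n → ℕ → Fin n
addMod {suc n} k a = (toℕ k + a) mod (suc n)

-- The graphs A_r = C_{2r} + r K_2^(2) and B_r = 2 C_r + r K_2^(2).  Edges:
--   inj₁ i       : the edge joining i and i+1   (A_r)  resp. i and i+2 (B_r)
--   inj₂ (i , t) : for i < r, the t-th (t ∈ {0,1}) edge joining i and i+r

A : ℕ → Graph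
A r = record
  { V = Fin (r + r)
  ; E = Fin (r + r) ⊎ (Fin r × Fin 2)
  ; ends = λ { (inj₁ i) → (i , addMod i 1)
             ; (inj₂ (i , _)) → (i ↑ˡ r , r ↑ʳ i) } }

B : ℕ → Graph
B r = record
  { V = Fin (r + r)
  ; E = Fin (r + r) ⊎ (Fin r × Fin 2)
  ; ends = λ { (inj₁ i) → (i , addMod i 2)
             ; (inj₂ (i , _)) → (i ↑ˡ r , r ↑ʳ i) } }

-- A cycle of length ℓ is given 0-indexed: edges e 0 … e (ℓ-1)
-- (paper's e_{k+1} is our e k), pairwise distinct, with vertices
-- α 0 … α (ℓ-1) (indices mod ℓ) such that e k joins α k and α (k+1).

record Cycle (G : Graph) : Set where
  field
    ℓ     : ℕ
    e     : Fin ℓ → E G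
    e-inj : ∀ i j → e i ≡ e j → i ≡ j
    α     : Fin ℓ → V G
    joins : ∀ k → Joins G (e k) (α k) (α (addMod k 1))

open Cycle public

IsEuler : {G : Graph} → Cycle G → Set
IsEuler {G} C = ∀ (x : E G) → ∃[ k ] (e C k ≡ x)

-- The maps φ, τ, φτ on E(C), represented on the index set Fin ℓ.
-- (0-indexed: φ : k ↦ k+1, τ : k ↦ ℓ-1-k, φτ : k ↦ ℓ-2-k, mod ℓ;
--  these are e_i ↦ e_{i+1}, e_i ↦ e_{ℓ+1-i}, e_i ↦ e_{ℓ-i} in 1-indexing.)

φ : ∀ {ℓ} → Fin ℓ → Fin ℓ
φ k = addMod k 1

τ : ∀ {ℓ} → Fin ℓ → Fin ℓ
τ {suc n} k = (n ∸ toℕ k) mod (suc n)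

φτ : ∀ {ℓ} → Fin ℓ → Fin ℓ
φτ {suc n} k = (n + (n ∸ toℕ k)) mod (suc n)

-- Subgroup of the permutations of Fin ℓ generated by a set S of maps
-- (maps considered up to pointwise equality).
data ⟨_⟩ {ℓ : ℕ} (S : (Fin ℓ → Fin ℓ) → Set) : (Fin ℓ → Fin ℓ) → Set where
  gen  : ∀ {f} → S f → ⟨ S ⟩ f
  one  : ⟨ S ⟩ id
  comp : ∀ {f g} → ⟨ S ⟩ f → ⟨ S ⟩ g → ⟨ S ⟩ (f ∘ g)
  inv  : ∀ {f g} → ⟨ S ⟩ f → (∀ x → g (f x) ≡ x) → (∀ x → f (g x) ≡ x) → ⟨ S ⟩ g
  ext  : ∀ {f g} → ⟨ S ⟩ f → (∀ x → f x ≡ g x) → ⟨ S ⟩ g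

[φ,τ] : ∀ {ℓ} → (Fin ℓ → Fin ℓ) → Set
[φ,τ] f = (∀ x → f x ≡ φ x) ⊎ (∀ x → f x ≡ τ x)

[φ²,φτ] : ∀ {ℓ} → (Fin ℓ → Fin ℓ) → Set
[φ²,φτ] f = (∀ x → f x ≡ φ (φ x)) ⊎ (∀ x → f x ≡ φτ x)

D : {G : Graph} (C : Cycle G) → (Fin (ℓ C) → Fin (ℓ C)) → Set
D C = ⟨ [φ,τ] ⟩

-- H(C): restrictions to E(C) of automorphisms leaving E(C) invariant and
-- restricting to an element of D(C).  An element e_k ↦ e_{π k} of D(C) is
-- in H(C) iff some automorphism g satisfies g(e_k) = e_{π k} for all k
-- (which in particular makes g leave E(C) invariant).
H : {G : Graph} (C : Cycle G) → (Fin (ℓ C) → Fin (ℓ C)) → Set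
H {G} C π = D C π × ∃[ g ] (∀ k → fE {G} g (e C k) ≡ e C (π k))

Symmetrical : {G : Graph} → Cycle G → Set
Symmetrical C = H C (φ ∘ φ)

HIsφ²φτ : {G : Graph} (C : Cycle G) → Set
HIsφ²φτ C = ∀ π → (H C π → ⟨ [φ²,φτ] ⟩ π) × (⟨ [φ²,φτ] ⟩ π → H C π)

module Submission where

-- Let N = 2r, and δ = 1 for A_r, δ = 2 for B_r: the edges are the rim edges i — i+δ and the
-- spokes i — i+r (two of them for each i < r), each repeated λ times.  Suppose an
-- automorphism g induces φ² on an Euler cycle C.  Spokes lie in parallel classes of size 2λ
-- and rim edges in classes of size λ, so g preserves the kind of an edge; hence C alternates
-- between spokes and rim edges, its length is even, and H(C) ⊆ ⟨φ², φτ⟩.  The vertex map of g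
-- shifts the vertex sequence of C by two places, which forces C to traverse all rim edges in
-- the same direction: otherwise the vertex sequence would be 4-periodic and meet only two rim
-- edges.  So vertices two places apart always differ by Δ = r ± δ, and the reflection
-- v ↦ K − v of ℤ_N induces φτ, whence H(C) = ⟨φ², φτ⟩.  For A_r with r odd, Δ is even and all
-- rim edges would start at vertices of one parity, which is absurd.  Conversely, if s = r + δ
-- is a unit modulo N (r even for A_r, r odd for B_r), walking v → v + r → v + s from the
-- starting points p·s, once for each of the λ copies, is an Euler cycle on which translation
-- by s induces φ².

open import Defs
open import Data.Nat using (ℕ; _≤_)
open import Data.Nat.Divisibility using (_∣_)
open import Data.Product using (_×_; ∃-syntax)
open import Relation.Nullary using (¬_)

open import Data.Bool using (Bool; true; false; not)
open import Data.Bool.Properties using (not-¬; ¬-not)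
open import Data.Empty using (⊥; ⊥-elim)
open import Data.Fin using (Fin; toℕ; _↑ˡ_; _↑ʳ_; splitAt; join; combine; remQuot) renaming (zero to 0F)
open import Data.Fin.Properties
  using (toℕ-injective; toℕ<n; toℕ-fromℕ<; toℕ-↑ˡ; toℕ-↑ʳ; toℕ-combine; injective⇒≤; ¬Fin0;
         combine-remQuot; remQuot-combine; splitAt-↑ˡ; splitAt-↑ʳ; join-splitAt)
open import Data.Nat
open import Data.Nat.DivMod
open import Data.Nat.Divisibility using (divides; m%n≡0⇒n∣m; *-cancelˡ-∣)
open import Data.Nat.Properties
open import Data.Nat.Tactic.RingSolver using (solve-∀)
open import Data.Product using (_,_; proj₁; proj₂; uncurry)
open import Data.Sum using (_⊎_; inj₁; inj₂)
open import Data.Sum.Properties using (inj₁-injective)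
open import Function using (_∘_; id)
open import Relation.Binary.Bundles using (Setoid)
open import Relation.Binary.PropositionalEquality
open import Algebra.Properties.CommutativeSemigroup +-commutativeSemigroup
  using (x∙yz≈yx∙z; xy∙z≈xz∙y; xy∙z≈y∙xz; xy∙z≈x∙zy)

pattern 1F = Fin.suc 0F

h+h≡h*2 : ∀ h → h + h ≡ h * 2
h+h≡h*2 = solve-∀

2+h+h≡[1+h]*2 : ∀ h → 2 + (h + h) ≡ suc h * 2
2+h+h≡[1+h]*2 = solve-∀

h+h≡2*h : ∀ h → h + h ≡ 2 * h
h+h≡2*h h = cong (h +_) (sym (+-identityʳ h))

double-suc : ∀ q k → suc q + suc q + k ≡ 2 + (q + q + k)
double-suc q k = cong (λ d → suc d + k) (+-suc q q)

even-or-odd : ∀ k → ∃[ x ] (k ≡ x + x ⊎ k ≡ suc (x + x))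
even-or-odd zero = 0 , inj₁ refl
even-or-odd (suc k) with even-or-odd k
... | x , inj₁ refl = x , inj₂ refl
... | x , inj₂ refl = suc x , inj₁ (cong suc (sym (+-suc x x)))

module Congruence (n : ℕ) .{{_ : NonZero n}} where

  infix 4 _≈_
  record _≈_ (x y : ℕ) : Set where
    constructor mk
    field %-≡ : x % n ≡ y % n

  ≈-refl : ∀ {x} → x ≈ x
  ≈-refl = mk refl

  ≈-sym : ∀ {x y} → x ≈ y → y ≈ x
  ≈-sym (mk p) = mk (sym p)

  ≈-trans : ∀ {x y z} → x ≈ y → y ≈ z → x ≈ z
  ≈-trans (mk p) (mk q) = mk (trans p q)

  ≡⇒≈ : ∀ {x y} → x ≡ y → x ≈ y
  ≡⇒≈ refl = ≈-refl

  ≈-setoid : Setoid _ _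
  ≈-setoid = record
    { Carrier = ℕ ; _≈_ = _≈_
    ; isEquivalence = record { refl = ≈-refl ; sym = ≈-sym ; trans = ≈-trans } }

  +-cong : ∀ {a b c d} → a ≈ b → c ≈ d → a + c ≈ b + d
  +-cong {a} {b} {c} {d} (mk p) (mk q) = mk (begin
    (a + c) % n           ≡⟨ %-distribˡ-+ a c n ⟩
    (a % n + c % n) % n   ≡⟨ cong₂ (λ u v → (u + v) % n) p q ⟩
    (b % n + d % n) % n   ≡⟨ %-distribˡ-+ b d n ⟨
    (b + d) % n           ∎)
    where open ≡-Reasoning

  *-cong : ∀ {a b c d} → a ≈ b → c ≈ d → a * c ≈ b * d
  *-cong {a} {b} {c} {d} (mk p) (mk q) = mk (begin
    (a * c) % n             ≡⟨ %-distribˡ-* a c n ⟩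
    (a % n * (c % n)) % n   ≡⟨ cong₂ (λ u v → (u * v) % n) p q ⟩
    (b % n * (d % n)) % n   ≡⟨ %-distribˡ-* b d n ⟨
    (b * d) % n             ∎)
    where open ≡-Reasoning

  module ≈-Reasoning where
    open import Relation.Binary.Reasoning.Setoid ≈-setoid public

  open ≈-Reasoning

  +-congˡ : ∀ {a b c} → a ≈ b → c + a ≈ c + b
  +-congˡ {c = c} = +-cong (≈-refl {c})

  +-congʳ : ∀ {a b c} → a ≈ b → a + c ≈ b + c
  +-congʳ {c = c} p = +-cong p (≈-refl {c})

  *-congˡ : ∀ {a b c} → a ≈ b → c * a ≈ c * b
  *-congˡ {c = c} = *-cong (≈-refl {c})

  *-congʳ : ∀ {a b c} → a ≈ b → a * c ≈ b * c
  *-congʳ {c = c} p = *-cong p (≈-refl {c})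

  m%n≈m : ∀ x → x % n ≈ x
  m%n≈m x = mk (m%n%n≡m%n x n)

  m+kn≈m : ∀ x k → x + k * n ≈ x
  m+kn≈m x k = mk ([m+kn]%n≡m%n x k n)

  m+n≈m : ∀ x → x + n ≈ x
  m+n≈m x = mk ([m+n]%n≡m%n x n)

  kn≈0 : ∀ k → k * n ≈ 0
  kn≈0 k = m+kn≈m 0 k

  n≈0 : n ≈ 0
  n≈0 = m+n≈m 0

  -_ : ℕ → ℕ
  - c = pred n * c

  +-inverseʳ : ∀ c → c + - c ≈ 0
  +-inverseʳ c = begin
    c + pred n * c  ≡⟨ cong (_* c) (suc-pred n) ⟩
    n * c           ≡⟨ *-comm n c ⟩
    c * n           ≈⟨ kn≈0 c ⟩
    0               ∎

  +-inverseˡ : ∀ c → - c + c ≈ 0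
  +-inverseˡ c = ≈-trans (≡⇒≈ (+-comm (- c) c)) (+-inverseʳ c)

  +-cancelʳ : ∀ {a b} c → a + c ≈ b + c → a ≈ b
  +-cancelʳ {a} {b} c p = begin
    a                ≡⟨ +-identityʳ a ⟨
    a + 0            ≈⟨ +-congˡ (+-inverseʳ c) ⟨
    a + (c + - c)    ≡⟨ +-assoc a c (- c) ⟨
    a + c + - c      ≈⟨ +-congʳ p ⟩
    b + c + - c      ≡⟨ +-assoc b c (- c) ⟩
    b + (c + - c)    ≈⟨ +-congˡ (+-inverseʳ c) ⟩
    b + 0            ≡⟨ +-identityʳ b ⟩
    b                ∎

  +-cancelˡ : ∀ {a b} c → c + a ≈ c + b → a ≈ b
  +-cancelˡ {a} {b} c p = +-cancelʳ c (begin
    a + c  ≡⟨ +-comm a c ⟩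
    c + a  ≈⟨ p ⟩
    c + b  ≡⟨ +-comm c b ⟩
    b + c  ∎)

  +-moveʳ : ∀ {a b} d → a + d ≈ b → a ≈ b + - d
  +-moveʳ {a} {b} d p = +-cancelʳ d (begin
    a + d          ≈⟨ p ⟩
    b              ≡⟨ +-identityʳ b ⟨
    b + 0          ≈⟨ +-congˡ (+-inverseˡ d) ⟨
    b + (- d + d)  ≡⟨ +-assoc b (- d) d ⟨
    b + - d + d    ∎)

  m+d≈m⇒d≈0 : ∀ {x d} → x + d ≈ x → d ≈ 0
  m+d≈m⇒d≈0 {x} {d} p = +-cancelˡ x (≈-trans p (≡⇒≈ (sym (+-identityʳ x))))

  ≈⇒≡ : ∀ {x y} → x < n → y < n → x ≈ y → x ≡ y
  ≈⇒≡ {x} {y} x<n y<n (mk p) = trans (sym (m<n⇒m%n≡m x<n)) (trans p (m<n⇒m%n≡m y<n))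

  toℕ-≈-injective : ∀ {i j : Fin n} → toℕ i ≈ toℕ j → i ≡ j
  toℕ-≈-injective {i} {j} p = toℕ-injective (≈⇒≡ (toℕ<n i) (toℕ<n j) p)

  toℕ-mod : ∀ x → toℕ (x mod n) ≈ x
  toℕ-mod x = ≈-trans (≡⇒≈ (toℕ-fromℕ< (m%n<n x n))) (m%n≈m x)

  ≈⇒%≡ : ∀ d .{{_ : NonZero d}} → d ∣ n → ∀ {x y} → x ≈ y → x % d ≡ y % d
  ≈⇒%≡ d d∣n {x} {y} (mk p) =
    trans (sym (m∣n⇒o%n%m≡o%m d n x d∣n)) (trans (cong (_% d) p) (m∣n⇒o%n%m≡o%m d n y d∣n))


  translate : ℕ → Fin n → Fin n
  translate c v = (toℕ v + c) mod n

  toℕ-translate : ∀ c v → toℕ (translate c v) ≈ toℕ v + c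
  toℕ-translate c v = toℕ-mod (toℕ v + c)

  translate-inverseʳ : ∀ c v → translate c (translate (- c) v) ≡ v
  translate-inverseʳ c v = toℕ-≈-injective (begin
    toℕ (translate c (translate (- c) v))  ≈⟨ toℕ-translate c (translate (- c) v) ⟩
    toℕ (translate (- c) v) + c            ≈⟨ +-congʳ (toℕ-translate (- c) v) ⟩
    toℕ v + - c + c                        ≡⟨ +-assoc (toℕ v) (- c) c ⟩
    toℕ v + (- c + c)                      ≈⟨ +-congˡ (+-inverseˡ c) ⟩
    toℕ v + 0                              ≡⟨ +-identityʳ (toℕ v) ⟩
    toℕ v                                  ∎)

  translate-inverseˡ : ∀ c v → translate (- c) (translate c v) ≡ v
  translate-inverseˡ c v = toℕ-≈-injective (begin
    toℕ (translate (- c) (translate c v))  ≈⟨ toℕ-translate (- c) (translate c v) ⟩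
    toℕ (translate c v) + - c              ≈⟨ +-congʳ (toℕ-translate c v) ⟩
    toℕ v + c + - c                        ≡⟨ +-assoc (toℕ v) c (- c) ⟩
    toℕ v + (c + - c)                      ≈⟨ +-congˡ (+-inverseʳ c) ⟩
    toℕ v + 0                              ≡⟨ +-identityʳ (toℕ v) ⟩
    toℕ v                                  ∎)

  reflect : ℕ → Fin n → Fin n
  reflect c v = (c + - toℕ v) mod n

  reflect-sum : ∀ c v → toℕ (reflect c v) + toℕ v ≈ c
  reflect-sum c v = begin
    toℕ (reflect c v) + toℕ v     ≈⟨ +-congʳ (toℕ-mod (c + - toℕ v)) ⟩
    c + - toℕ v + toℕ v           ≡⟨ +-assoc c (- toℕ v) (toℕ v) ⟩
    c + (- toℕ v + toℕ v)         ≈⟨ +-congˡ (+-inverseˡ (toℕ v)) ⟩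
    c + 0                         ≡⟨ +-identityʳ c ⟩
    c                             ∎

  reflect-involutive : ∀ c v → reflect c (reflect c v) ≡ v
  reflect-involutive c v = toℕ-≈-injective (+-cancelʳ (toℕ (reflect c v)) (begin
    toℕ (reflect c (reflect c v)) + toℕ (reflect c v)  ≈⟨ reflect-sum c (reflect c v) ⟩
    c                                                  ≈⟨ reflect-sum c v ⟨
    toℕ (reflect c v) + toℕ v                          ≡⟨ +-comm (toℕ (reflect c v)) (toℕ v) ⟩
    toℕ v + toℕ (reflect c v)                          ∎))

  scale : ℕ → Fin n → Fin n
  scale c v = (toℕ v * c) mod n

  toℕ-scale : ∀ c v → toℕ (scale c v) ≈ toℕ v * c
  toℕ-scale c v = toℕ-mod (toℕ v * c)

  scale-inverse : ∀ {c c′} → c′ * c ≈ 1 → ∀ v → scale c (scale c′ v) ≡ v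
  scale-inverse {c} {c′} c′c≈1 v = toℕ-≈-injective (begin
    toℕ (scale c (scale c′ v))   ≈⟨ toℕ-scale c (scale c′ v) ⟩
    toℕ (scale c′ v) * c         ≈⟨ *-congʳ (toℕ-scale c′ v) ⟩
    toℕ v * c′ * c               ≡⟨ *-assoc (toℕ v) c′ c ⟩
    toℕ v * (c′ * c)             ≈⟨ *-congˡ {c = toℕ v} c′c≈1 ⟩
    toℕ v * 1                    ≡⟨ *-identityʳ (toℕ v) ⟩
    toℕ v                        ∎)

toℕ-addMod : ∀ {m} (i : Fin (suc m)) a → let open Congruence (suc m) in toℕ (addMod i a) ≈ toℕ i + a
toℕ-addMod {m} i a = Congruence.toℕ-mod (suc m) (toℕ i + a)

module Dihedral (m : ℕ) where

  private
    L : ℕ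
    L = suc m

  open Congruence L
  open ≈-Reasoning

  IsRotation : ℕ → (Fin L → Fin L) → Set
  IsRotation c π = ∀ k → toℕ (π k) ≈ toℕ k + c

  IsReflection : ℕ → (Fin L → Fin L) → Set
  IsReflection c π = ∀ k → toℕ (π k) + toℕ k ≈ c

  IsDihedral : (Fin L → Fin L) → Set
  IsDihedral π = ∃[ c ] (IsRotation c π ⊎ IsReflection c π)

  φ-rotation : IsRotation 1 φ
  φ-rotation k = toℕ-addMod k 1

  private
    toℕ≤m : ∀ (k : Fin L) → toℕ k ≤ m
    toℕ≤m k = s≤s⁻¹ (toℕ<n k)

  φ⁻¹ : Fin L → Fin L
  φ⁻¹ k = addMod k m

  φ∘φ⁻¹ : φ ∘ φ⁻¹ ≗ id
  φ∘φ⁻¹ k = toℕ-≈-injective (begin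
    toℕ (φ (φ⁻¹ k))    ≈⟨ φ-rotation (φ⁻¹ k) ⟩
    toℕ (φ⁻¹ k) + 1    ≈⟨ +-congʳ (toℕ-addMod k m) ⟩
    toℕ k + m + 1      ≡⟨ trans (+-assoc (toℕ k) m 1) (cong (toℕ k +_) (+-comm m 1)) ⟩
    toℕ k + L          ≈⟨ m+n≈m (toℕ k) ⟩
    toℕ k              ∎)

  φ⁻¹∘φ : φ⁻¹ ∘ φ ≗ id
  φ⁻¹∘φ k = toℕ-≈-injective (begin
    toℕ (φ⁻¹ (φ k))    ≈⟨ toℕ-addMod (φ k) m ⟩
    toℕ (φ k) + m      ≈⟨ +-congʳ (φ-rotation k) ⟩
    toℕ k + 1 + m      ≡⟨ +-assoc (toℕ k) 1 m ⟩
    toℕ k + L          ≈⟨ m+n≈m (toℕ k) ⟩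
    toℕ k              ∎)

  τ-reflection : IsReflection m τ
  τ-reflection k = begin
    toℕ (τ k) + toℕ k   ≈⟨ +-congʳ (toℕ-mod (m ∸ toℕ k)) ⟩
    m ∸ toℕ k + toℕ k   ≡⟨ m∸n+n≡m (toℕ≤m k) ⟩
    m                   ∎

  φτ-reflection : IsReflection (m + m) φτ
  φτ-reflection k = begin
    toℕ (φτ k) + toℕ k         ≈⟨ +-congʳ (toℕ-mod (m + (m ∸ toℕ k))) ⟩
    m + (m ∸ toℕ k) + toℕ k    ≡⟨ +-assoc m (m ∸ toℕ k) (toℕ k) ⟩
    m + (m ∸ toℕ k + toℕ k)    ≡⟨ cong (m +_) (m∸n+n≡m (toℕ≤m k)) ⟩
    m + m                      ∎

  φτ-involutive : ∀ k → φτ (φτ k) ≡ k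
  φτ-involutive k = toℕ-≈-injective (+-cancelʳ (toℕ (φτ k)) (begin
    toℕ (φτ (φτ k)) + toℕ (φτ k)  ≈⟨ φτ-reflection (φτ k) ⟩
    m + m                         ≈⟨ φτ-reflection k ⟨
    toℕ (φτ k) + toℕ k            ≡⟨ +-comm (toℕ (φτ k)) (toℕ k) ⟩
    toℕ k + toℕ (φτ k)            ∎))

  τ∘φ≗φτ : τ ∘ φ ≗ φτ
  τ∘φ≗φτ k = toℕ-≈-injective (+-cancelʳ (toℕ k + 1) (begin
    toℕ (τ (φ k)) + (toℕ k + 1)   ≈⟨ +-congˡ (φ-rotation k) ⟨
    toℕ (τ (φ k)) + toℕ (φ k)     ≈⟨ τ-reflection (φ k) ⟩
    m                             ≈⟨ m+n≈m m ⟨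
    m + suc m                     ≡⟨ +-suc m m ⟩
    suc (m + m)                   ≡⟨ +-comm 1 (m + m) ⟩
    m + m + 1                     ≈⟨ +-congʳ (φτ-reflection k) ⟨
    toℕ (φτ k) + toℕ k + 1        ≡⟨ +-assoc (toℕ (φτ k)) (toℕ k) 1 ⟩
    toℕ (φτ k) + (toℕ k + 1)      ∎))

  ∘-dihedral : ∀ {f g} → IsDihedral f → IsDihedral g → IsDihedral (f ∘ g)
  ∘-dihedral {f} {g} (c , inj₁ rf) (d , inj₁ rg) = d + c , inj₁ λ k → begin
    toℕ (f (g k))    ≈⟨ rf (g k) ⟩
    toℕ (g k) + c    ≈⟨ +-congʳ (rg k) ⟩
    toℕ k + d + c    ≡⟨ +-assoc (toℕ k) d c ⟩
    toℕ k + (d + c)  ∎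
  ∘-dihedral {f} {g} (c , inj₂ rf) (d , inj₁ rg) = c + - d , inj₂ λ k → +-moveʳ d (begin
    toℕ (f (g k)) + toℕ k + d    ≡⟨ +-assoc (toℕ (f (g k))) (toℕ k) d ⟩
    toℕ (f (g k)) + (toℕ k + d)  ≈⟨ +-congˡ (rg k) ⟨
    toℕ (f (g k)) + toℕ (g k)    ≈⟨ rf (g k) ⟩
    c                            ∎)
  ∘-dihedral {f} {g} (c , inj₁ rf) (d , inj₂ rg) = d + c , inj₂ λ k → begin
    toℕ (f (g k)) + toℕ k      ≈⟨ +-congʳ (rf (g k)) ⟩
    toℕ (g k) + c + toℕ k      ≡⟨ xy∙z≈xz∙y (toℕ (g k)) c (toℕ k) ⟩
    toℕ (g k) + toℕ k + c      ≈⟨ +-congʳ (rg k) ⟩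
    d + c                      ∎
  ∘-dihedral {f} {g} (c , inj₂ rf) (d , inj₂ rg) = c + - d , inj₁ λ k → begin
    toℕ (f (g k))                 ≈⟨ +-moveʳ d (begin
      toℕ (f (g k)) + d                       ≈⟨ +-congˡ (rg k) ⟨
      toℕ (f (g k)) + (toℕ (g k) + toℕ k)     ≡⟨ +-assoc (toℕ (f (g k))) (toℕ (g k)) (toℕ k) ⟨
      toℕ (f (g k)) + toℕ (g k) + toℕ k       ≈⟨ +-congʳ (rf (g k)) ⟩
      c + toℕ k                               ∎) ⟩
    c + toℕ k + - d               ≡⟨ xy∙z≈y∙xz c (toℕ k) (- d) ⟩
    toℕ k + (c + - d)             ∎

  inverse-dihedral : ∀ {f g} → IsDihedral f → (∀ x → f (g x) ≡ x) → IsDihedral g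
  inverse-dihedral {f} {g} (c , inj₁ rf) fg = - c , inj₁ λ k → +-moveʳ c (begin
    toℕ (g k) + c    ≈⟨ rf (g k) ⟨
    toℕ (f (g k))    ≡⟨ cong toℕ (fg k) ⟩
    toℕ k            ∎)
  inverse-dihedral {f} {g} (c , inj₂ rf) fg = c , inj₂ λ k → begin
    toℕ (g k) + toℕ k        ≡⟨ +-comm (toℕ (g k)) (toℕ k) ⟩
    toℕ k + toℕ (g k)        ≡⟨ cong (λ z → toℕ z + toℕ (g k)) (fg k) ⟨
    toℕ (f (g k)) + toℕ (g k) ≈⟨ rf (g k) ⟩
    c                        ∎

  ≗-dihedral : ∀ {f g} → IsDihedral f → f ≗ g → IsDihedral g
  ≗-dihedral (c , inj₁ rf) f≗g = c , inj₁ λ k → subst (λ z → toℕ z ≈ toℕ k + c) (f≗g k) (rf k)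
  ≗-dihedral (c , inj₂ rf) f≗g = c , inj₂ λ k → subst (λ z → toℕ z + toℕ k ≈ c) (f≗g k) (rf k)

  ⟨φ,τ⟩⇒dihedral : ∀ {π} → ⟨ [φ,τ] ⟩ π → IsDihedral π
  ⟨φ,τ⟩⇒dihedral (gen (inj₁ π≗φ)) = ≗-dihedral (1 , inj₁ φ-rotation) (sym ∘ π≗φ)
  ⟨φ,τ⟩⇒dihedral (gen (inj₂ π≗τ)) = ≗-dihedral (m , inj₂ τ-reflection) (sym ∘ π≗τ)
  ⟨φ,τ⟩⇒dihedral one = 0 , inj₁ λ k → ≡⇒≈ (sym (+-identityʳ (toℕ k)))
  ⟨φ,τ⟩⇒dihedral (comp p q) = ∘-dihedral (⟨φ,τ⟩⇒dihedral p) (⟨φ,τ⟩⇒dihedral q)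
  ⟨φ,τ⟩⇒dihedral (inv p _ fg) = inverse-dihedral (⟨φ,τ⟩⇒dihedral p) fg
  ⟨φ,τ⟩⇒dihedral (ext p f≗g) = ≗-dihedral (⟨φ,τ⟩⇒dihedral p) f≗g

  φ²^ : ℕ → Fin L → Fin L
  φ²^ zero = id
  φ²^ (suc h) = (φ ∘ φ) ∘ φ²^ h

  φ²^∈⟨φ²,φτ⟩ : ∀ h → ⟨ [φ²,φτ] ⟩ (φ²^ h)
  φ²^∈⟨φ²,φτ⟩ zero = one
  φ²^∈⟨φ²,φτ⟩ (suc h) = comp (gen (inj₁ λ _ → refl)) (φ²^∈⟨φ²,φτ⟩ h)

  φ²^-rotation : ∀ h → IsRotation (h + h) (φ²^ h)
  φ²^-rotation zero k = ≡⇒≈ (sym (+-identityʳ (toℕ k)))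
  φ²^-rotation (suc h) k = begin
    toℕ (φ (φ (φ²^ h k)))       ≈⟨ φ-rotation (φ (φ²^ h k)) ⟩
    toℕ (φ (φ²^ h k)) + 1       ≈⟨ +-congʳ (φ-rotation (φ²^ h k)) ⟩
    toℕ (φ²^ h k) + 1 + 1       ≈⟨ +-congʳ (+-congʳ (φ²^-rotation h k)) ⟩
    toℕ k + (h + h) + 1 + 1     ≡⟨ add-two (toℕ k) h ⟩
    toℕ k + (suc h + suc h)     ∎
    where
    add-two : ∀ a h → a + (h + h) + 1 + 1 ≡ a + (suc h + suc h)
    add-two = solve-∀

  private
    halve : 2 ∣ L → ∀ {x y} → x ≈ y → y % 2 ≡ 0 → ∃[ q ] (x ≡ q + q)
    halve 2∣L {x} x≈y y-even with m%n≡0⇒n∣m x 2 (trans (≈⇒%≡ 2 2∣L x≈y) y-even)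
    ... | divides q x≡q*2 = q , trans x≡q*2 (sym (h+h≡h*2 q))

  even-dihedral⇒∈⟨φ²,φτ⟩ : 2 ∣ L → ∀ {π} → IsDihedral π → toℕ (π 0F) % 2 ≡ 0 → ⟨ [φ²,φτ] ⟩ π
  even-dihedral⇒∈⟨φ²,φτ⟩ 2∣L {π} (c , inj₁ rot) π0-even with halve 2∣L (≈-sym (rot 0F)) π0-even
  ... | q , c≡q+q = ext (φ²^∈⟨φ²,φτ⟩ q) λ k → toℕ-≈-injective (begin
    toℕ (φ²^ q k)      ≈⟨ φ²^-rotation q k ⟩
    toℕ k + (q + q)    ≡⟨ cong (toℕ k +_) c≡q+q ⟨
    toℕ k + c          ≈⟨ rot k ⟨
    toℕ (π k)          ∎)
  even-dihedral⇒∈⟨φ²,φτ⟩ 2∣L {π} (c , inj₂ ref) π0-even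
    with halve 2∣L (≈-trans (≈-sym (ref 0F)) (≡⇒≈ (+-identityʳ _))) π0-even
  ... | q , c≡q+q = ext (comp (φ²^∈⟨φ²,φτ⟩ (suc q)) (gen (inj₂ λ _ → refl))) λ k →
    toℕ-≈-injective (+-cancelʳ (toℕ k) (begin
      toℕ (φ²^ (suc q) (φτ k)) + toℕ k        ≈⟨ +-congʳ (φ²^-rotation (suc q) (φτ k)) ⟩
      toℕ (φτ k) + (suc q + suc q) + toℕ k    ≡⟨ xy∙z≈xz∙y (toℕ (φτ k)) (suc q + suc q) (toℕ k) ⟩
      toℕ (φτ k) + toℕ k + (suc q + suc q)    ≈⟨ +-congʳ (φτ-reflection k) ⟩
      m + m + (suc q + suc q)                 ≡⟨ regroup m q ⟩
      q + q + 2 * suc m                       ≈⟨ m+kn≈m (q + q) 2 ⟩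
      q + q                                   ≡⟨ c≡q+q ⟨
      c                                       ≈⟨ ref k ⟨
      toℕ (π k) + toℕ k                       ∎))
    where
    regroup : ∀ m q → m + m + (suc q + suc q) ≡ q + q + 2 * suc m
    regroup = solve-∀

module Automorphisms {G : Graph} where

  idᴬ : Automorphism G
  idᴬ = record
    { fV = id ; fV⁻¹ = id ; fV-l = λ _ → refl ; fV-r = λ _ → refl
    ; fE = id ; fE⁻¹ = id ; fE-l = λ _ → refl ; fE-r = λ _ → refl
    ; inc⇒ = λ _ _ p → p ; inc⇐ = λ _ _ p → p }

  _∘ᴬ_ : Automorphism G → Automorphism G → Automorphism G
  g ∘ᴬ h = record
    { fV = fV g ∘ fV h ; fV⁻¹ = fV⁻¹ h ∘ fV⁻¹ g
    ; fV-l = λ v → trans (cong (fV⁻¹ h) (fV-l g (fV h v))) (fV-l h v)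
    ; fV-r = λ v → trans (cong (fV g) (fV-r h (fV⁻¹ g v))) (fV-r g v)
    ; fE = fE g ∘ fE h ; fE⁻¹ = fE⁻¹ h ∘ fE⁻¹ g
    ; fE-l = λ x → trans (cong (fE⁻¹ h) (fE-l g (fE h x))) (fE-l h x)
    ; fE-r = λ x → trans (cong (fE g) (fE-r h (fE⁻¹ g x))) (fE-r g x)
    ; inc⇒ = λ v x p → inc⇒ g (fV h v) (fE h x) (inc⇒ h v x p)
    ; inc⇐ = λ v x p → inc⇐ h v x (inc⇐ g (fV h v) (fE h x) p) }

  inc⇐⁻¹ : (g : Automorphism G) → ∀ v x → Inc G v (fE g x) → Inc G (fV⁻¹ g v) x
  inc⇐⁻¹ g v x p = inc⇐ g (fV⁻¹ g v) x (subst (λ w → Inc G w (fE g x)) (sym (fV-r g v)) p)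

  invᴬ : Automorphism G → Automorphism G
  invᴬ g = record
    { fV = fV⁻¹ g ; fV⁻¹ = fV g ; fV-l = fV-r g ; fV-r = fV-l g
    ; fE = fE⁻¹ g ; fE⁻¹ = fE g ; fE-l = fE-r g ; fE-r = fE-l g
    ; inc⇒ = λ v x p → inc⇐⁻¹ g v (fE⁻¹ g x) (subst (Inc G v) (sym (fE-r g x)) p)
    ; inc⇐ = λ v x p → subst₂ (Inc G) (fV-r g v) (fE-r g x) (inc⇒ g (fV⁻¹ g v) (fE⁻¹ g x) p) }

  Parallel : E G → E G → Set
  Parallel x y = ∀ v → Inc G v x → Inc G v y

  fE-parallel : (g : Automorphism G) → ∀ {x y} → Parallel x y → Parallel (fE g x) (fE g y)
  fE-parallel g {x} {y} x∥y v p =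
    subst (λ w → Inc G w (fE g y)) (fV-r g v) (inc⇒ g (fV⁻¹ g v) y (x∥y (fV⁻¹ g v) (inc⇐⁻¹ g v x p)))

  Joins⇒Inc₁ : ∀ x {v w} → Joins G x v w → Inc G v x
  Joins⇒Inc₁ _ (inj₁ eq) = inj₁ (sym (cong proj₁ eq))
  Joins⇒Inc₁ _ (inj₂ eq) = inj₂ (sym (cong proj₂ eq))

  Joins⇒Inc₂ : ∀ x {v w} → Joins G x v w → Inc G w x
  Joins⇒Inc₂ _ (inj₁ eq) = inj₂ (sym (cong proj₂ eq))
  Joins⇒Inc₂ _ (inj₂ eq) = inj₁ (sym (cong proj₁ eq))

  Joins⇒Inc : ∀ x {v w u} → Joins G x v w → u ≡ v ⊎ u ≡ w → Inc G u x
  Joins⇒Inc x j (inj₁ refl) = Joins⇒Inc₁ x j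
  Joins⇒Inc x j (inj₂ refl) = Joins⇒Inc₂ x j

  Inc⇒end : ∀ x {v w u} → Joins G x v w → Inc G u x → u ≡ v ⊎ u ≡ w
  Inc⇒end _ (inj₁ eq) (inj₁ p) = inj₁ (trans p (cong proj₁ eq))
  Inc⇒end _ (inj₁ eq) (inj₂ p) = inj₂ (trans p (cong proj₂ eq))
  Inc⇒end _ (inj₂ eq) (inj₁ p) = inj₂ (trans p (cong proj₁ eq))
  Inc⇒end _ (inj₂ eq) (inj₂ p) = inj₁ (trans p (cong proj₂ eq))

  module _ (C : Cycle G) where

    Realizes : (Fin (ℓ C) → Fin (ℓ C)) → Set
    Realizes π = ∃[ g ] (∀ k → fE {G} g (e C k) ≡ e C (π k))

    H-≗ : ∀ {π π′} → H C π → π ≗ π′ → H C π′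
    H-≗ (dπ , g , gπ) π≗π′ = ext dπ π≗π′ , g , λ k → trans (gπ k) (cong (e C) (π≗π′ k))

    ⟨⟩⊆H : ∀ {S π} → (∀ {f} → S f → H C f) → ⟨ S ⟩ π → H C π
    ⟨⟩⊆H S⊆H (gen s) = S⊆H s
    ⟨⟩⊆H S⊆H one = one , idᴬ , λ _ → refl
    ⟨⟩⊆H S⊆H (comp {g = π₂} p q) with ⟨⟩⊆H S⊆H p | ⟨⟩⊆H S⊆H q
    ... | dp , g , gp | dq , h , hq = comp dp dq , g ∘ᴬ h , λ k → trans (cong (fE g) (hq k)) (gp (π₂ k))
    ⟨⟩⊆H S⊆H (inv {g = π⁻¹} p π⁻¹π ππ⁻¹) with ⟨⟩⊆H S⊆H p
    ... | dp , g , gp = inv dp π⁻¹π ππ⁻¹ , invᴬ g , λ k →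
      trans (cong (fE⁻¹ g) (trans (cong (e C) (sym (ππ⁻¹ k))) (sym (gp (π⁻¹ k))))) (fE-l g (e C (π⁻¹ k)))
    ⟨⟩⊆H S⊆H (ext p π≗π′) = H-≗ (⟨⟩⊆H S⊆H p) π≗π′

    MapsEnds : (Fin (ℓ C) → Fin (ℓ C)) → (V G → V G) → Set
    MapsEnds π ρ = ∀ k →
      (ρ (α C k) ≡ α C (π k) × ρ (α C (φ k)) ≡ α C (φ (π k))) ⊎
      (ρ (α C k) ≡ α C (φ (π k)) × ρ (α C (φ k)) ≡ α C (π k))

    module _ (euler : IsEuler C)
      (π π⁻¹ : Fin (ℓ C) → Fin (ℓ C)) (π∘π⁻¹ : π ∘ π⁻¹ ≗ id) (π⁻¹∘π : π⁻¹ ∘ π ≗ id)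
      (ρ ρ⁻¹ : V G → V G) (ρ∘ρ⁻¹ : ρ ∘ ρ⁻¹ ≗ id) (ρ⁻¹∘ρ : ρ⁻¹ ∘ ρ ≗ id)
      (ρ-maps-ends : MapsEnds π ρ)
      where

      private
        index : E G → Fin (ℓ C)
        index x = proj₁ (euler x)

        e-index : ∀ x → e C (index x) ≡ x
        e-index x = proj₂ (euler x)

        index-e : ∀ k → index (e C k) ≡ k
        index-e k = e-inj C _ _ (e-index (e C k))

        ρ-injective : ∀ {u v} → ρ u ≡ ρ v → u ≡ v
        ρ-injective {u} {v} p = trans (sym (ρ⁻¹∘ρ u)) (trans (cong ρ⁻¹ p) (ρ⁻¹∘ρ v))

        Inc⇒ends : ∀ {v} k → Inc G v (e C k) → v ≡ α C k ⊎ v ≡ α C (φ k)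
        Inc⇒ends k = Inc⇒end (e C k) (joins C k)

        ends⇒Inc : ∀ {v} k → v ≡ α C k ⊎ v ≡ α C (φ k) → Inc G v (e C k)
        ends⇒Inc k = Joins⇒Inc (e C k) (joins C k)

        preserves : ∀ {v} k → Inc G v (e C k) → Inc G (ρ v) (e C (π k))
        preserves k p with Inc⇒ends k p | ρ-maps-ends k
        ... | inj₁ refl | inj₁ (ρ₁ , _) = ends⇒Inc (π k) (inj₁ ρ₁)
        ... | inj₂ refl | inj₁ (_ , ρ₂) = ends⇒Inc (π k) (inj₂ ρ₂)
        ... | inj₁ refl | inj₂ (ρ₁ , _) = ends⇒Inc (π k) (inj₂ ρ₁)
        ... | inj₂ refl | inj₂ (_ , ρ₂) = ends⇒Inc (π k) (inj₁ ρ₂)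

        reflects : ∀ {v} k → Inc G (ρ v) (e C (π k)) → Inc G v (e C k)
        reflects k p with Inc⇒ends (π k) p | ρ-maps-ends k
        ... | inj₁ q | inj₁ (ρ₁ , _) = ends⇒Inc k (inj₁ (ρ-injective (trans q (sym ρ₁))))
        ... | inj₂ q | inj₁ (_ , ρ₂) = ends⇒Inc k (inj₂ (ρ-injective (trans q (sym ρ₂))))
        ... | inj₁ q | inj₂ (_ , ρ₂) = ends⇒Inc k (inj₂ (ρ-injective (trans q (sym ρ₂))))
        ... | inj₂ q | inj₂ (ρ₁ , _) = ends⇒Inc k (inj₁ (ρ-injective (trans q (sym ρ₁))))

        along : (Fin (ℓ C) → Fin (ℓ C)) → E G → E G
        along f x = e C (f (index x))

        along-inverse : ∀ f g → f ∘ g ≗ id → ∀ x → along f (along g x) ≡ x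
        along-inverse f g fg x =
          trans (cong (e C ∘ f) (index-e (g (index x)))) (trans (cong (e C) (fg (index x))) (e-index x))

      automorphism : Automorphism G
      automorphism = record
        { fV = ρ ; fV⁻¹ = ρ⁻¹ ; fV-l = ρ⁻¹∘ρ ; fV-r = ρ∘ρ⁻¹
        ; fE = along π ; fE⁻¹ = along π⁻¹
        ; fE-l = along-inverse π⁻¹ π π⁻¹∘π ; fE-r = along-inverse π π⁻¹ π∘π⁻¹
        ; inc⇒ = λ v x p → preserves (index x) (subst (Inc G v) (sym (e-index x)) p)
        ; inc⇐ = λ v x p → subst (Inc G v) (e-index x) (reflects (index x) p) }

      realizes : Realizes π
      realizes = automorphism , λ k → cong (e C ∘ π) (index-e k)

-- Γ^(λ) for Γ = A_r (δ = 1) or B_r (δ = 2).  The end map is a parameter specified by its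
-- values, so that both A r ^⁽ λ ⁾ and B r ^⁽ λ ⁾ are instances up to definitional equality.
module Circulant (r′ δ λ′ : ℕ) (0<δ : 0 < δ) (δ<r : δ < suc r′)
  (ends₀ : Fin (suc r′ + suc r′) ⊎ (Fin (suc r′) × Fin 2) → Fin (suc r′ + suc r′) × Fin (suc r′ + suc r′))
  (ends₀-rim : ∀ i → ends₀ (inj₁ i) ≡ (i , addMod i δ))
  (ends₀-spoke : ∀ i u → ends₀ (inj₂ (i , u)) ≡ (i ↑ˡ suc r′ , suc r′ ↑ʳ i))
  where

  r N Λ : ℕ
  r = suc r′
  N = r + r
  Λ = suc λ′

  Edge : Set
  Edge = (Fin N ⊎ (Fin r × Fin 2)) × Fin Λ

  G : Graph
  G = record { V = Fin N ; E = Edge ; ends = ends₀ ∘ proj₁ }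

  pattern rim i t = (inj₁ i , t)
  pattern spoke i u t = (inj₂ (i , u) , t)

  isSpoke : Edge → Bool
  isSpoke (rim _ _) = false
  isSpoke (spoke _ _ _) = true

  open Congruence N public
  open ≈-Reasoning
  open Automorphisms {G}

  r<N : r < N
  r<N = m<m+n r (s≤s z≤n)

  2≤r : 2 ≤ r
  2≤r = ≤-trans (s≤s 0<δ) δ<r

  N≰2 : ¬ N ≤ 2
  N≰2 N≤2 with ≤-trans (+-mono-≤ 2≤r 2≤r) N≤2
  ... | s≤s (s≤s ())

  private
    positive⇒≉0 : ∀ {x} → 0 < x → x < N → ¬ x ≈ 0
    positive⇒≉0 0<x x<N x≈0 = <⇒≢ 0<x (sym (≈⇒≡ x<N (s≤s z≤n) x≈0))

  δ≉0 : ¬ δ ≈ 0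
  δ≉0 = positive⇒≉0 0<δ (<-trans δ<r r<N)

  δ+δ≉0 : ¬ δ + δ ≈ 0
  δ+δ≉0 = positive⇒≉0 (<-≤-trans 0<δ (m≤m+n δ δ)) (+-mono-< δ<r δ<r)

  r+δ≉0 : ¬ r + δ ≈ 0
  r+δ≉0 = positive⇒≉0 (s≤s z≤n) (+-monoʳ-< r δ<r)

  δ≉r : ¬ δ ≈ r
  δ≉r δ≈r = <⇒≢ δ<r (≈⇒≡ (<-trans δ<r r<N) r<N δ≈r)

  Inc-rim : ∀ {v} m t → Inc G v (rim m t) → v ≡ m ⊎ v ≡ addMod m δ
  Inc-rim {v} m _ = subst (λ P → v ≡ proj₁ P ⊎ v ≡ proj₂ P) (ends₀-rim m)

  rim-Inc : ∀ {v} m t → v ≡ m ⊎ v ≡ addMod m δ → Inc G v (rim m t)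
  rim-Inc {v} m _ = subst (λ P → v ≡ proj₁ P ⊎ v ≡ proj₂ P) (sym (ends₀-rim m))

  Inc-spoke : ∀ {v} i u t → Inc G v (spoke i u t) → toℕ v ≡ toℕ i ⊎ toℕ v ≡ r + toℕ i
  Inc-spoke {v} i u _ p with subst (λ P → v ≡ proj₁ P ⊎ v ≡ proj₂ P) (ends₀-spoke i u) p
  ... | inj₁ refl = inj₁ (toℕ-↑ˡ i r)
  ... | inj₂ refl = inj₂ (toℕ-↑ʳ r i)

  rim-determined-by-ends : ∀ j y → Inc G j y → Inc G (addMod j δ) y → proj₁ y ≡ inj₁ j
  rim-determined-by-ends j (rim m t) p q with Inc-rim m t p | Inc-rim m t q
  ... | inj₁ refl | _ = refl
  ... | inj₂ refl | inj₁ j+δ≡m = ⊥-elim (δ+δ≉0 (m+d≈m⇒d≈0 (begin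
    toℕ m + (δ + δ)            ≡⟨ +-assoc (toℕ m) δ δ ⟨
    toℕ m + δ + δ              ≈⟨ +-congʳ (toℕ-addMod m δ) ⟨
    toℕ (addMod m δ) + δ       ≈⟨ toℕ-addMod (addMod m δ) δ ⟨
    toℕ (addMod (addMod m δ) δ) ≡⟨ cong toℕ j+δ≡m ⟩
    toℕ m                      ∎)))
  ... | inj₂ refl | inj₂ j+δ≡j = ⊥-elim (δ≉0 (m+d≈m⇒d≈0 (begin
    toℕ (addMod m δ) + δ       ≈⟨ toℕ-addMod (addMod m δ) δ ⟨
    toℕ (addMod (addMod m δ) δ) ≡⟨ cong toℕ j+δ≡j ⟩
    toℕ (addMod m δ)           ∎)))
  rim-determined-by-ends j (spoke i u t) p q with Inc-spoke i u t p | Inc-spoke i u t q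
  ... | inj₁ j≡i | inj₁ j+δ≡i = ⊥-elim (δ≉0 (m+d≈m⇒d≈0 (begin
    toℕ j + δ           ≈⟨ toℕ-addMod j δ ⟨
    toℕ (addMod j δ)    ≡⟨ trans j+δ≡i (sym j≡i) ⟩
    toℕ j               ∎)))
  ... | inj₂ j≡r+i | inj₂ j+δ≡r+i = ⊥-elim (δ≉0 (m+d≈m⇒d≈0 (begin
    toℕ j + δ           ≈⟨ toℕ-addMod j δ ⟨
    toℕ (addMod j δ)    ≡⟨ trans j+δ≡r+i (sym j≡r+i) ⟩
    toℕ j               ∎)))
  ... | inj₁ j≡i | inj₂ j+δ≡r+i = ⊥-elim (δ≉r (+-cancelˡ (toℕ i) (begin
    toℕ i + δ           ≡⟨ cong (_+ δ) j≡i ⟨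
    toℕ j + δ           ≈⟨ toℕ-addMod j δ ⟨
    toℕ (addMod j δ)    ≡⟨ trans j+δ≡r+i (+-comm r (toℕ i)) ⟩
    toℕ i + r           ∎)))
  ... | inj₂ j≡r+i | inj₁ j+δ≡i = ⊥-elim (r+δ≉0 (+-cancelˡ (toℕ i) (begin
    toℕ i + (r + δ)     ≡⟨ +-assoc (toℕ i) r δ ⟨
    toℕ i + r + δ       ≡⟨ cong (λ z → z + δ) (trans (+-comm (toℕ i) r) (sym j≡r+i)) ⟩
    toℕ j + δ           ≈⟨ toℕ-addMod j δ ⟨
    toℕ (addMod j δ)    ≡⟨ trans j+δ≡i (sym (+-identityʳ (toℕ i))) ⟩
    toℕ i + 0           ∎)))

  private
    spoke-label : Edge → Fin 2 × Fin Λ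
    spoke-label (rim _ t) = 0F , t
    spoke-label (spoke _ u t) = u , t

  -- the 2λ edges parallel to a spoke cannot be mapped injectively into the λ copies of a rim edge
  spoke↦spoke : ∀ (g : Automorphism G) i u t → isSpoke (fE g (spoke i u t)) ≡ true
  spoke↦spoke g i u t with fE g (spoke i u t) in g[x]≡rim
  ... | spoke _ _ _ = refl
  ... | rim j t₀ = ⊥-elim (m+1+n≰m Λ (injective⇒≤ {f = F ∘ remQuot {2} Λ} F∘remQuot-injective))
    where
    parallel-copy : Fin 2 × Fin Λ → Edge
    parallel-copy a = spoke i (proj₁ a) (proj₂ a)

    copy-parallel : ∀ a → Parallel (spoke i u t) (parallel-copy a)
    copy-parallel a v = subst (λ P → v ≡ proj₁ P ⊎ v ≡ proj₂ P) (trans (ends₀-spoke i u) (sym (ends₀-spoke i (proj₁ a))))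

    image-is-rim-j : ∀ a → proj₁ (fE g (parallel-copy a)) ≡ inj₁ j
    image-is-rim-j a = rim-determined-by-ends j (fE g (parallel-copy a))
      (g∥ j (subst (Inc G j) (sym g[x]≡rim) (rim-Inc j t₀ (inj₁ refl))))
      (g∥ (addMod j δ) (subst (Inc G (addMod j δ)) (sym g[x]≡rim) (rim-Inc j t₀ (inj₂ refl))))
      where g∥ = fE-parallel g (copy-parallel a)

    F : Fin 2 × Fin Λ → Fin Λ
    F a = proj₂ (fE g (parallel-copy a))

    F-injective : ∀ {a b} → F a ≡ F b → a ≡ b
    F-injective {a} {b} Fa≡Fb = cong spoke-label {x = parallel-copy a} {y = parallel-copy b} (trans (sym (fE-l g (parallel-copy a)))
      (trans (cong (fE⁻¹ g) (cong₂ _,_ (trans (image-is-rim-j a) (sym (image-is-rim-j b))) Fa≡Fb))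
             (fE-l g (parallel-copy b))))

    F∘remQuot-injective : ∀ {a b} → F (remQuot Λ a) ≡ F (remQuot Λ b) → a ≡ b
    F∘remQuot-injective {a} {b} p =
      trans (sym (combine-remQuot {2} Λ a)) (trans (cong (uncurry combine) (F-injective p)) (combine-remQuot {2} Λ b))

  isSpoke-preserved : ∀ (g : Automorphism G) x → isSpoke (fE g x) ≡ isSpoke x
  isSpoke-preserved g (spoke i u t) = spoke↦spoke g i u t
  isSpoke-preserved g (rim m t) with fE g (rim m t) in g[x]≡
  ... | rim _ _ = refl
  ... | spoke i u t′ = ⊥-elim (not-¬ x-is-rim (trans (sym (cong isSpoke (fE-l g (rim m t))))
                                   (subst (λ y → isSpoke (fE⁻¹ g y) ≡ true) (sym g[x]≡) (spoke↦spoke (invᴬ g) i u t′))))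
    where
    x-is-rim : isSpoke (rim m t) ≡ false
    x-is-rim = refl

  isSpoke-rim : ∀ y {m} → proj₁ y ≡ inj₁ m → isSpoke y ≡ false
  isSpoke-rim (rim _ _) refl = refl

  common-vertex-unique : ∀ x y {v w} → isSpoke x ≢ isSpoke y →
    Inc G v x → Inc G v y → Inc G w x → Inc G w y → v ≡ w
  common-vertex-unique (rim m t) y x≢y vx vy wx wy with Inc-rim m t vx | Inc-rim m t wx
  ... | inj₁ refl | inj₁ refl = refl
  ... | inj₂ refl | inj₂ refl = refl
  ... | inj₁ refl | inj₂ refl = ⊥-elim (x≢y (sym (isSpoke-rim y (rim-determined-by-ends m y vy wy))))
  ... | inj₂ refl | inj₁ refl = ⊥-elim (x≢y (sym (isSpoke-rim y (rim-determined-by-ends m y wy vy))))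
  common-vertex-unique (spoke i u t) (rim m t′) x≢y vx vy wx wy =
    common-vertex-unique (rim m t′) (spoke i u t) (x≢y ∘ sym) vy vx wy wx
  common-vertex-unique (spoke _ _ _) (spoke _ _ _) x≢y _ _ _ _ = ⊥-elim (x≢y refl)

  spoke-step : ∀ x {v w} → isSpoke x ≡ true → Joins G x v w → toℕ w ≈ toℕ v + r
  spoke-step (spoke i u t) _ (inj₁ eq) with trans (sym (ends₀-spoke i u)) eq
  ... | refl = begin
    toℕ (r ↑ʳ i)       ≡⟨ toℕ-↑ʳ r i ⟩
    r + toℕ i          ≡⟨ +-comm r (toℕ i) ⟩
    toℕ i + r          ≡⟨ cong (_+ r) (toℕ-↑ˡ i r) ⟨
    toℕ (i ↑ˡ r) + r   ∎
  spoke-step (spoke i u t) _ (inj₂ eq) with trans (sym (ends₀-spoke i u)) eq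
  ... | refl = begin
    toℕ (i ↑ˡ r)       ≡⟨ toℕ-↑ˡ i r ⟩
    toℕ i              ≈⟨ m+n≈m (toℕ i) ⟨
    toℕ i + (r + r)    ≡⟨ x∙yz≈yx∙z (toℕ i) r r ⟩
    r + toℕ i + r      ≡⟨ cong (_+ r) (toℕ-↑ʳ r i) ⟨
    toℕ (r ↑ʳ i) + r   ∎

  rim-step : ∀ m t {v w} → Joins G (rim m t) v w →
    (v ≡ m × toℕ w ≈ toℕ v + δ) ⊎ (w ≡ m × toℕ v ≈ toℕ w + δ)
  rim-step m t (inj₁ eq) with trans (sym (ends₀-rim m)) eq
  ... | refl = inj₁ (refl , toℕ-addMod m δ)
  rim-step m t (inj₂ eq) with trans (sym (ends₀-rim m)) eq
  ... | refl = inj₂ (refl , toℕ-addMod m δ)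

  data Orientation : Set where
    forward backward : Orientation

  shift : Orientation → ℕ
  shift forward = δ
  shift backward = - δ

  label-offset : Orientation → ℕ
  label-offset forward = 0
  label-offset backward = - δ

  rim-offset : ∀ x {v w} → isSpoke x ≡ false → Joins G x v w → ∃[ o ] toℕ w ≈ toℕ v + shift o
  rim-offset (rim m t) _ j with rim-step m t j
  ... | inj₁ (_ , w≈v+δ) = forward , w≈v+δ
  ... | inj₂ (_ , v≈w+δ) = backward , +-moveʳ δ (≈-sym v≈w+δ)

module SymmetricalCycle (r′ δ λ′ : ℕ) (0<δ : 0 < δ) (δ<r : δ < suc r′)
  (ends₀ : Fin (suc r′ + suc r′) ⊎ (Fin (suc r′) × Fin 2) → Fin (suc r′ + suc r′) × Fin (suc r′ + suc r′))
  (ends₀-rim : ∀ i → ends₀ (inj₁ i) ≡ (i , addMod i δ))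
  (ends₀-spoke : ∀ i u → ends₀ (inj₂ (i , u)) ≡ (i ↑ˡ suc r′ , suc r′ ↑ʳ i))
  where

  open Circulant r′ δ λ′ 0<δ δ<r ends₀ ends₀-rim ends₀-spoke
  open Automorphisms {G}

  module _ (n : ℕ) (e₀ : Fin (suc n) → Edge) (e₀-injective : ∀ i j → e₀ i ≡ e₀ j → i ≡ j)
           (α₀ : Fin (suc n) → Fin N) (joins₀ : ∀ k → Joins G (e₀ k) (α₀ k) (α₀ (addMod k 1)))
           where

    C : Cycle G
    C = record { ℓ = suc n ; e = e₀ ; e-inj = e₀-injective ; α = α₀ ; joins = joins₀ }

    L : ℕ
    L = suc n

    module ℤL = Congruence L
    open Dihedral n

    -- Positions on C are read modulo L, making edge, vertex and pos L-periodic sequences on ℕ.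
    opaque
      idx : ℕ → Fin L
      idx k = k mod L

      idx-≈ : ∀ {j k} → j ℤL.≈ k → idx j ≡ idx k
      idx-≈ {j} {k} j≈k = ℤL.toℕ-≈-injective (begin
        toℕ (idx j)   ≈⟨ ℤL.toℕ-mod j ⟩
        j             ≈⟨ j≈k ⟩
        k             ≈⟨ ℤL.toℕ-mod k ⟨
        toℕ (idx k)   ∎)
        where open ℤL.≈-Reasoning

      idx-toℕ : ∀ k → idx (toℕ k) ≡ k
      idx-toℕ k = ℤL.toℕ-≈-injective (ℤL.toℕ-mod (toℕ k))

      idx-suc : ∀ k → φ (idx k) ≡ idx (suc k)
      idx-suc k = ℤL.toℕ-≈-injective (begin
        toℕ (φ (idx k))     ≈⟨ toℕ-addMod (idx k) 1 ⟩
        toℕ (idx k) + 1     ≈⟨ ℤL.+-congʳ (ℤL.toℕ-mod k) ⟩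
        k + 1               ≡⟨ +-comm k 1 ⟩
        suc k               ≈⟨ ℤL.toℕ-mod (suc k) ⟨
        toℕ (idx (suc k))   ∎)
        where open ℤL.≈-Reasoning

    idx-wrap : ∀ j k → idx (j + k * n + k) ≡ idx j
    idx-wrap j k = idx-≈ (ℤL.≈-trans (ℤL.≡⇒≈ (wrap j k n)) (ℤL.m+kn≈m j k))
      where
      wrap : ∀ j k n → j + k * n + k ≡ j + k * suc n
      wrap = solve-∀

    idx-suc-cong : ∀ {j k} → idx j ≡ idx k → idx (suc j) ≡ idx (suc k)
    idx-suc-cong {j} {k} p = trans (sym (idx-suc j)) (trans (cong φ p) (idx-suc k))

    edge : ℕ → Edge
    edge k = e₀ (idx k)

    vertex : ℕ → Fin N
    vertex k = α₀ (idx k)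

    pos : ℕ → ℕ
    pos k = toℕ (vertex k)

    kind : ℕ → Bool
    kind k = isSpoke (edge k)

    edge-joins : ∀ k → Joins G (edge k) (vertex k) (vertex (suc k))
    edge-joins k = subst (λ i → Joins G (edge k) (vertex k) (α₀ i)) (idx-suc k) (joins₀ (idx k))

    vertex-≈ : ∀ {j k} → j ℤL.≈ k → vertex j ≡ vertex k
    vertex-≈ = cong α₀ ∘ idx-≈

    module _ (euler : IsEuler C) (symmetrical : Symmetrical C) where

      g₀ : Automorphism G
      g₀ = proj₁ (proj₂ symmetrical)

      g₀-shifts : ∀ k → fE g₀ (e₀ k) ≡ e₀ (φ (φ k))
      g₀-shifts = proj₂ (proj₂ symmetrical)

      position : Edge → ℕ
      position x = toℕ (proj₁ (euler x))

      edge-position : ∀ x → edge (position x) ≡ x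
      edge-position x = trans (cong e₀ (idx-toℕ (proj₁ (euler x)))) (proj₂ (euler x))

      g₀-shifts-edges : ∀ k → fE g₀ (edge k) ≡ edge (2 + k)
      g₀-shifts-edges k = trans (g₀-shifts (idx k)) (cong e₀ (trans (cong φ (idx-suc k)) (idx-suc (suc k))))

      kind-2-periodic : ∀ k → kind (2 + k) ≡ kind k
      kind-2-periodic k = trans (cong isSpoke (sym (g₀-shifts-edges k))) (isSpoke-preserved g₀ (edge k))

      kind-even-shift : ∀ h k → kind (h + h + k) ≡ kind k
      kind-even-shift zero k = refl
      kind-even-shift (suc h) k =
        trans (cong (λ d → kind (suc d + k)) (+-suc h h)) (trans (kind-2-periodic (h + h + k)) (kind-even-shift h k))

      kind-constant : ∀ k → kind (suc k) ≡ kind k → ∀ j → kind j ≡ kind k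
      kind-constant k step j = trans (cong isSpoke (cong e₀ (sym (idx-wrap j k)))) (proj₁ (from (j + k * n)))
        where
        from : ∀ d → kind (d + k) ≡ kind k × kind (suc d + k) ≡ kind k
        from zero = refl , step
        from (suc d) = proj₂ (from d) , trans (kind-2-periodic (d + k)) (proj₁ (from d))

      kind-alternates : ∀ k → kind (suc k) ≡ not (kind k)
      kind-alternates k = ¬-not λ same → not-¬ refl (begin
        false                                      ≡⟨ cong isSpoke (edge-position (rim 0F 0F)) ⟨
        kind (position (rim 0F 0F))          ≡⟨ kind-constant k same _ ⟩
        kind k                                     ≡⟨ kind-constant k same _ ⟨
        kind (position (spoke 0F 0F 0F))  ≡⟨ cong isSpoke (edge-position (spoke 0F 0F 0F)) ⟩
        true                                       ∎)
        where open ≡-Reasoning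

      kinds-differ : ∀ k → kind k ≢ kind (suc k)
      kinds-differ k same = not-¬ refl (trans same (kind-alternates k))

      same-kind⇒even : ∀ d k → kind (d + k) ≡ kind k → ∃[ h ] d ≡ h + h
      same-kind⇒even zero k _ = 0 , refl
      same-kind⇒even (suc zero) k same = ⊥-elim (kinds-differ k (sym same))
      same-kind⇒even (suc (suc d)) k same with same-kind⇒even d k (trans (sym (kind-2-periodic (d + k))) same)
      ... | h , refl = suc h , cong suc (sym (+-suc h h))

      same-kind⇒reachable : ∀ j k → kind j ≡ kind k → ∃[ q ] idx j ≡ idx (q + q + k)
      same-kind⇒reachable j k same
        with same-kind⇒even (j + k * n) k (trans (cong isSpoke (cong e₀ (idx-wrap j k))) same)
      ... | q , d≡q+q = q , trans (sym (idx-wrap j k)) (cong (λ d → idx (d + k)) d≡q+q)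

      period-even : ∃[ h ] L ≡ h + h
      period-even = same-kind⇒even L 0 (cong isSpoke (cong e₀ (idx-≈ (ℤL.≈-trans (ℤL.≡⇒≈ (+-identityʳ L)) ℤL.n≈0))))

      2∣L : 2 ∣ L
      2∣L with period-even
      ... | h , L≡h+h = divides h (trans L≡h+h (h+h≡h*2 h))

      H⊆⟨φ²,φτ⟩ : ∀ π → H C π → ⟨ [φ²,φτ] ⟩ π
      H⊆⟨φ²,φτ⟩ π (dπ , g , g-realizes) = even-dihedral⇒∈⟨φ²,φτ⟩ 2∣L (⟨φ,τ⟩⇒dihedral dπ) π0-even
        where
        open ≡-Reasoning
        same : kind (toℕ (π 0F) + 0) ≡ kind 0
        same = begin
          isSpoke (e₀ (idx (toℕ (π 0F) + 0)))  ≡⟨ cong (isSpoke ∘ e₀) (trans (cong idx (+-identityʳ _)) (idx-toℕ (π 0F))) ⟩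
          isSpoke (e₀ (π 0F))                  ≡⟨ cong isSpoke (g-realizes 0F) ⟨
          isSpoke (fE g (e₀ 0F))               ≡⟨ isSpoke-preserved g (e₀ 0F) ⟩
          isSpoke (e₀ 0F)                      ≡⟨ cong (isSpoke ∘ e₀) (idx-toℕ 0F) ⟨
          isSpoke (e₀ (idx 0))                 ∎
        π0-even : toℕ (π 0F) % 2 ≡ 0
        π0-even with same-kind⇒even (toℕ (π 0F)) 0 same
        ... | h , π0≡h+h = trans (cong (_% 2) (trans π0≡h+h (h+h≡h*2 h))) (m*n%n≡0 h 2)

      σ : Fin N → Fin N
      σ = fV g₀

      -- vertex (1 + k) is the only common end of edge k and edge (1 + k), which differ in kind
      σ-shifts-next : ∀ k → σ (vertex (suc k)) ≡ vertex (3 + k)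
      σ-shifts-next k = common-vertex-unique (edge (2 + k)) (edge (3 + k)) (kinds-differ (2 + k))
        (subst (Inc G _) (g₀-shifts-edges k) (inc⇒ g₀ _ _ (Joins⇒Inc₂ (edge k) (edge-joins k))))
        (subst (Inc G _) (g₀-shifts-edges (suc k)) (inc⇒ g₀ _ _ (Joins⇒Inc₁ (edge (suc k)) (edge-joins (suc k)))))
        (Joins⇒Inc₂ (edge (2 + k)) (edge-joins (2 + k)))
        (Joins⇒Inc₁ (edge (3 + k)) (edge-joins (3 + k)))

      σ-shifts : ∀ k → σ (vertex k) ≡ vertex (2 + k)
      σ-shifts (suc k) = σ-shifts-next k
      σ-shifts zero = begin
        σ (vertex 0)        ≡⟨ cong σ (vertex-≈ (ℤL.≈-sym ℤL.n≈0)) ⟩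
        σ (vertex (suc n))  ≡⟨ σ-shifts-next n ⟩
        vertex (2 + L)      ≡⟨ vertex-≈ (ℤL.m+n≈m 2) ⟩
        vertex 2            ∎
        where open ≡-Reasoning

      vertex-shift-cong : ∀ {j k} → vertex j ≡ vertex k → vertex (2 + j) ≡ vertex (2 + k)
      vertex-shift-cong {j} {k} p = trans (sym (σ-shifts j)) (trans (cong σ p) (σ-shifts k))

      open ≈-Reasoning

      Step : ℕ → ℕ → Set
      Step k w = pos (suc k) ≈ pos k + w

      spoke-pos-step : ∀ {k} → kind k ≡ true → Step k r
      spoke-pos-step {k} spoke-k = spoke-step (edge k) spoke-k (edge-joins k)

      spoke-pos-step⁻¹ : ∀ {k} → kind k ≡ true → pos k ≈ pos (suc k) + r
      spoke-pos-step⁻¹ {k} spoke-k = ≈-sym (begin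
        pos (suc k) + r   ≈⟨ +-congʳ (spoke-pos-step spoke-k) ⟩
        pos k + r + r     ≡⟨ +-assoc (pos k) r r ⟩
        pos k + N         ≈⟨ m+n≈m (pos k) ⟩
        pos k             ∎)

      rim-pos-step : ∀ {k} → kind k ≡ false → ∃[ o ] Step k (shift o)
      rim-pos-step {k} rim-k = rim-offset (edge k) rim-k (edge-joins k)

      rim-after-rim : ∀ {k} → kind k ≡ false → kind (2 + k) ≡ false
      rim-after-rim {k} rim-k = trans (kind-2-periodic k) rim-k

      spoke-after-rim : ∀ {k} → kind k ≡ false → kind (suc k) ≡ true
      spoke-after-rim {k} rim-k = trans (kind-alternates k) (cong not rim-k)

      rim-after-spoke : ∀ {k} → kind k ≡ true → kind (suc k) ≡ false
      rim-after-spoke {k} spoke-k = trans (kind-alternates k) (cong not spoke-k)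

      reversal-returns : ∀ {k w w′} → kind k ≡ false → Step k w → Step (2 + k) w′ → w + w′ ≈ 0 →
        pos (4 + k) ≈ pos k
      reversal-returns {k} {w} {w′} rim-k step step′ w+w′≈0 = begin
        pos (4 + k)                   ≈⟨ spoke-pos-step (spoke-after-rim (rim-after-rim rim-k)) ⟩
        pos (3 + k) + r               ≈⟨ +-congʳ step′ ⟩
        pos (2 + k) + w′ + r          ≈⟨ +-congʳ (+-congʳ (spoke-pos-step (spoke-after-rim rim-k))) ⟩
        pos (1 + k) + r + w′ + r      ≈⟨ +-congʳ (+-congʳ (+-congʳ step)) ⟩
        pos k + w + r + w′ + r        ≡⟨ regroup (pos k) w r w′ ⟩
        pos k + (w + w′) + (r + r)    ≈⟨ m+n≈m (pos k + (w + w′)) ⟩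
        pos k + (w + w′)              ≈⟨ +-congˡ w+w′≈0 ⟩
        pos k + 0                     ≡⟨ +-identityʳ (pos k) ⟩
        pos k                         ∎
        where
        regroup : ∀ x w r w′ → x + w + r + w′ + r ≡ x + (w + w′) + (r + r)
        regroup = solve-∀

      SameEnds : ℕ → ℕ → Set
      SameEnds j k = vertex j ≡ vertex k × vertex (suc j) ≡ vertex (suc k)

      SameEnds-trans : ∀ {i j k} → SameEnds i j → SameEnds j k → SameEnds i k
      SameEnds-trans (p , p′) (q , q′) = trans p q , trans p′ q′

      SameEnds-sym : ∀ {j k} → SameEnds j k → SameEnds k j
      SameEnds-sym (p , p′) = sym p , sym p′

      idx⇒SameEnds : ∀ {j k} → idx j ≡ idx k → SameEnds j k
      idx⇒SameEnds p = cong α₀ p , cong α₀ (idx-suc-cong p)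

      SameEnds⇒Parallel : ∀ {j k} → SameEnds j k → Parallel (edge j) (edge k)
      SameEnds⇒Parallel {j} {k} (p , p′) v v∈j with Inc⇒end (edge j) (edge-joins j) v∈j
      ... | inj₁ v≡j = Joins⇒Inc (edge k) (edge-joins k) (inj₁ (trans v≡j p))
      ... | inj₂ v≡j′ = Joins⇒Inc (edge k) (edge-joins k) (inj₂ (trans v≡j′ p′))


      rims-with-same-ends : ∀ {m m′} → SameEnds (position (rim m 0F)) (position (rim m′ 0F)) → m ≡ m′
      rims-with-same-ends {m} {m′} s = sym (inj₁-injective
        (rim-determined-by-ends m (rim m′ 0F) (parallel m (rim-Inc m 0F (inj₁ refl)))
                                                 (parallel (addMod m δ) (rim-Inc m 0F (inj₂ refl)))))
        where
        parallel : Parallel (rim m 0F) (rim m′ 0F)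
        parallel v = subst (Inc G v) (edge-position (rim m′ 0F)) ∘ SameEnds⇒Parallel s v
                   ∘ subst (Inc G v) (sym (edge-position (rim m 0F)))

      -- If the walk returns after four steps, σ makes the whole vertex sequence 4-periodic, so
      -- every rim edge has one of two pairs of ends; but the N ≥ 4 rim edges have distinct ends.
      module _ (X : ℕ) (rim-X : kind X ≡ false) (returns : pos (4 + X) ≈ pos X) where

        period-4 : ∀ q → SameEnds (4 + (q + q + X)) (q + q + X)
        period-4 zero = toℕ-≈-injective returns , toℕ-≈-injective (begin
          pos (5 + X)        ≈⟨ spoke-pos-step⁻¹ (spoke-after-rim (rim-after-rim (rim-after-rim rim-X))) ⟩
          pos (6 + X) + r    ≡⟨ cong (λ v → toℕ v + r) (vertex-shift-cong (toℕ-≈-injective returns)) ⟩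
          pos (2 + X) + r    ≈⟨ spoke-pos-step⁻¹ (spoke-after-rim rim-X) ⟨
          pos (1 + X)        ∎)
        period-4 (suc q) with period-4 q
        ... | p , p′ = subst (λ j → SameEnds (4 + j) j) (sym (double-suc q X)) (vertex-shift-cong p , vertex-shift-cong p′)

        two-end-pairs : ∀ q → SameEnds (q + q + X) X ⊎ SameEnds (q + q + X) (2 + X)
        two-end-pairs zero = inj₁ (refl , refl)
        two-end-pairs (suc zero) = inj₂ (refl , refl)
        two-end-pairs (suc (suc q)) with subst (λ j → SameEnds j (q + q + X)) (sym four-more) (period-4 q) | two-end-pairs q
          where
          four-more : suc (suc q) + suc (suc q) + X ≡ 4 + (q + q + X)
          four-more = trans (double-suc (suc q) X) (cong (2 +_) (double-suc q X))
        ... | back | inj₁ p = inj₁ (SameEnds-trans back p)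
        ... | back | inj₂ p = inj₂ (SameEnds-trans back p)

        rim-ends : ∀ m → SameEnds (position (rim m 0F)) X ⊎ SameEnds (position (rim m 0F)) (2 + X)
        rim-ends m with same-kind⇒reachable (position (rim m 0F)) X
                          (trans (cong isSpoke (edge-position (rim m 0F))) (sym rim-X))
        ... | q , p with two-end-pairs q
        ...   | inj₁ s = inj₁ (SameEnds-trans (idx⇒SameEnds p) s)
        ...   | inj₂ s = inj₂ (SameEnds-trans (idx⇒SameEnds p) s)

        side : Fin N → Fin 2
        side m with rim-ends m
        ... | inj₁ _ = 0F
        ... | inj₂ _ = 1F

        side-injective : ∀ {m m′} → side m ≡ side m′ → m ≡ m′
        side-injective {m} {m′} with rim-ends m | rim-ends m′
        ... | inj₁ s | inj₁ s′ = λ _ → rims-with-same-ends (SameEnds-trans s (SameEnds-sym s′))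
        ... | inj₂ s | inj₂ s′ = λ _ → rims-with-same-ends (SameEnds-trans s (SameEnds-sym s′))
        ... | inj₁ _ | inj₂ _ = λ ()
        ... | inj₂ _ | inj₁ _ = λ ()

      no-reversal : ∀ X → kind X ≡ false → ¬ pos (4 + X) ≈ pos X
      no-reversal X rim-X returns = N≰2 (injective⇒≤ (side-injective X rim-X returns))

      k₀ : ℕ
      k₀ = position (rim 0F 0F)

      rim-k₀ : kind k₀ ≡ false
      rim-k₀ = cong isSpoke (edge-position (rim 0F 0F))

      o₀ : Orientation
      o₀ = proj₁ (rim-pos-step rim-k₀)

      orientation-kept : ∀ {X} o → kind X ≡ false → Step X (shift o) → Step (2 + X) (shift o)
      orientation-kept {X} forward rim-X step with rim-pos-step (rim-after-rim rim-X)
      ... | forward  , step′ = step′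
      ... | backward , step′ = ⊥-elim (no-reversal X rim-X (reversal-returns rim-X step step′ (+-inverseʳ δ)))
      orientation-kept {X} backward rim-X step with rim-pos-step (rim-after-rim rim-X)
      ... | backward , step′ = step′
      ... | forward  , step′ = ⊥-elim (no-reversal X rim-X (reversal-returns rim-X step step′ (+-inverseˡ δ)))

      rim-steps-from-k₀ : ∀ q → Step (q + q + k₀) (shift o₀)
      rim-steps-from-k₀ zero = proj₂ (rim-pos-step rim-k₀)
      rim-steps-from-k₀ (suc q) = subst (λ j → Step j (shift o₀)) (sym (double-suc q k₀))
        (orientation-kept o₀ (trans (kind-even-shift q k₀) rim-k₀) (rim-steps-from-k₀ q))

      Step-SameEnds : ∀ {j k w} → SameEnds j k → Step k w → Step j w
      Step-SameEnds {j} {k} {w} (p , p′) step = begin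
        pos (suc j)   ≡⟨ cong toℕ p′ ⟩
        pos (suc k)   ≈⟨ step ⟩
        pos k + w     ≡⟨ cong (λ v → toℕ v + w) p ⟨
        pos j + w     ∎

      rim-step-uniform : ∀ {k} → kind k ≡ false → Step k (shift o₀)
      rim-step-uniform {k} rim-k with same-kind⇒reachable k k₀ (trans rim-k (sym rim-k₀))
      ... | q , p = Step-SameEnds (idx⇒SameEnds p) (rim-steps-from-k₀ q)

      Δ : ℕ
      Δ = r + shift o₀

      pos-2-step : ∀ k → pos (2 + k) ≈ pos k + Δ
      pos-2-step k with kind k in kind-k
      ... | false = begin
        pos (2 + k)              ≈⟨ spoke-pos-step (spoke-after-rim kind-k) ⟩
        pos (1 + k) + r          ≈⟨ +-congʳ (rim-step-uniform kind-k) ⟩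
        pos k + shift o₀ + r     ≡⟨ xy∙z≈x∙zy (pos k) (shift o₀) r ⟩
        pos k + Δ                ∎
      ... | true = begin
        pos (2 + k)              ≈⟨ rim-step-uniform (rim-after-spoke kind-k) ⟩
        pos (1 + k) + shift o₀   ≈⟨ +-congʳ (spoke-pos-step kind-k) ⟩
        pos k + r + shift o₀     ≡⟨ +-assoc (pos k) r (shift o₀) ⟩
        pos k + Δ                ∎

      pos-linear : ∀ q k → pos (q + q + k) ≈ pos k + q * Δ
      pos-linear zero k = ≡⇒≈ (sym (+-identityʳ (pos k)))
      pos-linear (suc q) k = begin
        pos (suc q + suc q + k)     ≡⟨ cong pos (double-suc q k) ⟩
        pos (2 + (q + q + k))       ≈⟨ pos-2-step (q + q + k) ⟩
        pos (q + q + k) + Δ         ≈⟨ +-congʳ (pos-linear q k) ⟩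
        pos k + q * Δ + Δ           ≡⟨ xy∙z≈x∙zy (pos k) (q * Δ) Δ ⟩
        pos k + (Δ + q * Δ)         ∎

      half-period : ℕ
      half-period = proj₁ period-even

      half-period-Δ≈0 : half-period * Δ ≈ 0
      half-period-Δ≈0 = +-cancelˡ (pos 0) (begin
        pos 0 + half-period * Δ           ≈⟨ pos-linear half-period 0 ⟨
        pos (half-period + half-period + 0) ≡⟨ cong pos (trans (+-identityʳ _) (sym (proj₂ period-even))) ⟩
        pos L                             ≡⟨ cong toℕ (vertex-≈ ℤL.n≈0) ⟩
        pos 0                             ≡⟨ +-identityʳ (pos 0) ⟨
        pos 0 + 0                         ∎)

      double-period⇒Δ≈0 : ∀ z → z + z ℤL.≈ 0 → z * Δ ≈ 0
      double-period⇒Δ≈0 z (ℤL.mk p) with *-cancelˡ-∣ {half-period} {z} 2 2h∣2z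
        where
        2h∣2z : 2 * half-period ∣ 2 * z
        2h∣2z = subst₂ _∣_ (trans (proj₂ period-even) (h+h≡2*h half-period)) (h+h≡2*h z) (m%n≡0⇒n∣m (z + z) L p)
      ... | divides t z≡t*h = begin
        z * Δ                   ≡⟨ cong (_* Δ) z≡t*h ⟩
        t * half-period * Δ     ≡⟨ *-assoc t half-period Δ ⟩
        t * (half-period * Δ)   ≈⟨ *-congˡ {c = t} half-period-Δ≈0 ⟩
        t * 0                   ≡⟨ *-zeroʳ t ⟩
        0                       ∎

      odd≉0 : ∀ z → ¬ suc (z + z) ℤL.≈ 0
      odd≉0 z odd≈0 with trans (sym odd%2≡1) (ℤL.≈⇒%≡ 2 2∣L odd≈0)
        where
        odd%2≡1 : suc (z + z) % 2 ≡ 1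
        odd%2≡1 = trans (cong (λ x → suc x % 2) (h+h≡h*2 z)) ([m+kn]%n≡m%n 1 z 2)
      ... | ()

      -- K = pos 0 + pos (L − 1), and pos (L − 1) ≈ pos 1 + (half-period − 1) * Δ ≈ pos 1 − Δ.
      K : ℕ
      K = pos 0 + pos 1 + - Δ

      pos-reflection-even-odd : ∀ x y → (x + y + 1) + (x + y + 1) ℤL.≈ 0 → pos (x + x) + pos (suc (y + y)) ≈ K
      pos-reflection-even-odd x y 2[x+y+1]≈0 = begin
        pos (x + x) + pos (suc (y + y))   ≡⟨ cong₂ (λ i j → pos i + pos j) (sym (+-identityʳ (x + x))) (+-comm 1 (y + y)) ⟩
        pos (x + x + 0) + pos (y + y + 1) ≈⟨ +-cong (pos-linear x 0) (pos-linear y 1) ⟩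
        pos 0 + x * Δ + (pos 1 + y * Δ)   ≡⟨ regroup (pos 0) (pos 1) x y Δ ⟩
        pos 0 + pos 1 + (x + y) * Δ       ≈⟨ +-congˡ (+-moveʳ Δ [x+y+1]Δ≈0) ⟩
        K                                 ∎
        where
        regroup : ∀ a b x y d → a + x * d + (b + y * d) ≡ a + b + (x + y) * d
        regroup = solve-∀
        distrib : ∀ x y d → (x + y) * d + d ≡ (x + y + 1) * d
        distrib = solve-∀
        [x+y+1]Δ≈0 : (x + y) * Δ + Δ ≈ 0
        [x+y+1]Δ≈0 = ≈-trans (≡⇒≈ (distrib x y Δ)) (double-period⇒Δ≈0 (x + y + 1) 2[x+y+1]≈0)

      pos-reflection : ∀ i j → i + j + 1 ℤL.≈ 0 → pos i + pos j ≈ K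
      pos-reflection i j i+j+1≈0 with even-or-odd i | even-or-odd j
      ... | x , inj₁ refl | y , inj₂ refl =
        pos-reflection-even-odd x y (ℤL.≈-trans (ℤL.≡⇒≈ (arrange x y)) i+j+1≈0)
        where
        arrange : ∀ x y → (x + y + 1) + (x + y + 1) ≡ x + x + suc (y + y) + 1
        arrange = solve-∀
      ... | x , inj₂ refl | y , inj₁ refl = ≈-trans (≡⇒≈ (+-comm (pos (suc (x + x))) (pos (y + y))))
        (pos-reflection-even-odd y x (ℤL.≈-trans (ℤL.≡⇒≈ (arrange x y)) i+j+1≈0))
        where
        arrange : ∀ x y → (y + x + 1) + (y + x + 1) ≡ suc (x + x) + (y + y) + 1
        arrange = solve-∀
      ... | x , inj₁ refl | y , inj₁ refl = ⊥-elim (odd≉0 (x + y) (ℤL.≈-trans (ℤL.≡⇒≈ (arrange x y)) i+j+1≈0))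
        where
        arrange : ∀ x y → suc ((x + y) + (x + y)) ≡ x + x + (y + y) + 1
        arrange = solve-∀
      ... | x , inj₂ refl | y , inj₂ refl = ⊥-elim (odd≉0 (x + y + 1) (ℤL.≈-trans (ℤL.≡⇒≈ (arrange x y)) i+j+1≈0))
        where
        arrange : ∀ x y → suc ((x + y + 1) + (x + y + 1)) ≡ suc (x + x) + suc (y + y) + 1
        arrange = solve-∀

      ρ : Fin N → Fin N
      ρ = reflect K

      ρ-vertex : ∀ i j → i + j + 1 ℤL.≈ 0 → ρ (vertex i) ≡ vertex j
      ρ-vertex i j i+j+1≈0 = toℕ-≈-injective (+-cancelʳ (pos i) (begin
        toℕ (ρ (vertex i)) + pos i   ≈⟨ reflect-sum K (vertex i) ⟩
        K                            ≈⟨ pos-reflection i j i+j+1≈0 ⟨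
        pos i + pos j                ≡⟨ +-comm (pos i) (pos j) ⟩
        pos j + pos i                ∎))

      α₀≡vertex : ∀ k → α₀ k ≡ vertex (toℕ k)
      α₀≡vertex k = cong α₀ (sym (idx-toℕ k))

      α₀∘φ≡vertex : ∀ k → α₀ (φ k) ≡ vertex (suc (toℕ k))
      α₀∘φ≡vertex k = cong α₀ (trans (cong φ (sym (idx-toℕ k))) (idx-suc (toℕ k)))

      φτ-sum : ∀ k → toℕ (φτ k) + toℕ k + 2 ℤL.≈ 0
      φτ-sum k = ℤL.≈-trans (ℤL.+-congʳ (φτ-reflection k)) (ℤL.≈-trans (ℤL.≡⇒≈ (arrange n)) (ℤL.m+kn≈m 0 2))
        where
        arrange : ∀ n → n + n + 2 ≡ 0 + 2 * suc n
        arrange = solve-∀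

      ρ-maps-ends : MapsEnds C φτ ρ
      ρ-maps-ends k = inj₂
        ( trans (cong ρ (α₀≡vertex k)) (trans (ρ-vertex (toℕ k) (suc (toℕ (φτ k))) sum₁) (sym (α₀∘φ≡vertex (φτ k))))
        , trans (cong ρ (α₀∘φ≡vertex k)) (trans (ρ-vertex (suc (toℕ k)) (toℕ (φτ k)) sum₂) (sym (α₀≡vertex (φτ k)))) )
        where
        arrange₁ : ∀ a b → a + suc b + 1 ≡ b + a + 2
        arrange₁ = solve-∀
        arrange₂ : ∀ a b → suc a + b + 1 ≡ b + a + 2
        arrange₂ = solve-∀
        sum₁ : toℕ k + suc (toℕ (φτ k)) + 1 ℤL.≈ 0
        sum₁ = ℤL.≈-trans (ℤL.≡⇒≈ (arrange₁ (toℕ k) (toℕ (φτ k)))) (φτ-sum k)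
        sum₂ : suc (toℕ k) + toℕ (φτ k) + 1 ℤL.≈ 0
        sum₂ = ℤL.≈-trans (ℤL.≡⇒≈ (arrange₂ (toℕ k) (toℕ (φτ k)))) (φτ-sum k)

      φτ∈H : H C φτ
      φτ∈H = ext (comp (gen (inj₂ λ _ → refl)) (gen (inj₁ λ _ → refl))) τ∘φ≗φτ
           , realizes C euler φτ φτ φτ-involutive φτ-involutive ρ ρ (reflect-involutive K) (reflect-involutive K) ρ-maps-ends

      H≡⟨φ²,φτ⟩ : HIsφ²φτ C
      H≡⟨φ²,φτ⟩ π = H⊆⟨φ²,φτ⟩ π , ⟨⟩⊆H C generators-in-H
        where
        generators-in-H : ∀ {f} → [φ²,φτ] f → H C f
        generators-in-H (inj₁ f≗φ²) = H-≗ C symmetrical (sym ∘ f≗φ²)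
        generators-in-H (inj₂ f≗φτ) = H-≗ C φτ∈H (sym ∘ f≗φτ)

      rim-label : ∀ m t → toℕ m ≈ pos (position (rim m t)) + label-offset o₀
      rim-label m t = label-from o₀ (rim-step-uniform rim-j) (rim-step m t joins-j)
        where
        j = position (rim m t)

        rim-j : kind j ≡ false
        rim-j = cong isSpoke (edge-position (rim m t))

        joins-j : Joins G (rim m t) (vertex j) (vertex (suc j))
        joins-j = subst (λ x → Joins G x (vertex j) (vertex (suc j))) (edge-position (rim m t)) (edge-joins j)

        label-from : ∀ o → Step j (shift o) →
          (vertex j ≡ m × pos (suc j) ≈ pos j + δ) ⊎ (vertex (suc j) ≡ m × pos j ≈ pos (suc j) + δ) →
          toℕ m ≈ pos j + label-offset o
        label-from forward _ (inj₁ (j≡m , _)) = ≡⇒≈ (trans (cong toℕ (sym j≡m)) (sym (+-identityʳ (pos j))))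
        label-from forward step (inj₂ (_ , back)) = ⊥-elim (δ+δ≉0 (m+d≈m⇒d≈0 (begin
          pos j + (δ + δ)    ≡⟨ +-assoc (pos j) δ δ ⟨
          pos j + δ + δ      ≈⟨ +-congʳ step ⟨
          pos (suc j) + δ    ≈⟨ back ⟨
          pos j              ∎)))
        label-from backward step (inj₁ (_ , forth)) = ⊥-elim (δ+δ≉0 (begin
          δ + δ              ≈⟨ +-congʳ (+-cancelˡ (pos j) (≈-trans (≈-sym forth) step)) ⟩
          - δ + δ            ≈⟨ +-inverseˡ δ ⟩
          0                  ∎))
        label-from backward step (inj₂ (j+1≡m , _)) = ≈-trans (≡⇒≈ (cong toℕ (sym j+1≡m))) step

      -- For A_r with r odd, Δ = r ± 1 is even, so the labels of all rim edges have the parity of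
      -- pos k₀ + label-offset o₀; but the labels 0 and 1 = 0 + δ differ in parity.
      module _ (δ≡1 : δ ≡ 1) (h : ℕ) (r′≡h+h : r′ ≡ h + h) where

        private
          module ℤ₂ = Congruence 2

          reduce : ∀ {x y} → x ≈ y → x ℤ₂.≈ y
          reduce = ℤ₂.mk ∘ ≈⇒%≡ 2 (divides r (h+h≡h*2 r))

        r-odd : r ℤ₂.≈ 1
        r-odd = ℤ₂.≈-trans (ℤ₂.≡⇒≈ (cong suc (trans r′≡h+h (h+h≡h*2 h)))) (ℤ₂.m+kn≈m 1 h)

        shift-odd : ∀ o → shift o ℤ₂.≈ 1
        shift-odd forward = ℤ₂.≡⇒≈ δ≡1
        shift-odd backward = ℤ₂.+-cancelʳ 1 (ℤ₂.≈-trans (ℤ₂.≡⇒≈ (cong (- δ +_) (sym δ≡1)))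
                                           (ℤ₂.≈-trans (reduce (+-inverseˡ δ)) (ℤ₂.≈-sym ℤ₂.n≈0)))

        Δ-even : Δ ℤ₂.≈ 0
        Δ-even = ℤ₂.≈-trans (ℤ₂.+-cong r-odd (shift-odd o₀)) ℤ₂.n≈0

        rim-pos-parity : ∀ {j} → kind j ≡ false → pos j ℤ₂.≈ pos k₀
        rim-pos-parity {j} rim-j with same-kind⇒reachable j k₀ (trans rim-j (sym rim-k₀))
        ... | q , p = ℤ₂.≈-trans (ℤ₂.≡⇒≈ (cong (toℕ ∘ α₀) p))
                     (ℤ₂.≈-trans (reduce (pos-linear q k₀))
                     (ℤ₂.≈-trans (ℤ₂.+-congˡ (ℤ₂.*-congˡ {c = q} Δ-even))
                                 (ℤ₂.≡⇒≈ (trans (cong (pos k₀ +_) (*-zeroʳ q)) (+-identityʳ (pos k₀))))))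

        label-parity : ∀ m → toℕ m ℤ₂.≈ pos k₀ + label-offset o₀
        label-parity m = ℤ₂.≈-trans (reduce (rim-label m 0F)) (ℤ₂.+-congʳ (rim-pos-parity (cong isSpoke (edge-position (rim m 0F)))))

        1≉0 : ¬ 1 ℤ₂.≈ 0
        1≉0 (ℤ₂.mk ())

        odd-r-contradiction : ⊥
        odd-r-contradiction = 1≉0 (ℤ₂.≈-trans (ℤ₂.≡⇒≈ (sym δ≡1)) (ℤ₂.≈-trans (ℤ₂.≈-sym (reduce (toℕ-addMod 0F δ)))
                                    (ℤ₂.≈-trans (label-parity (addMod 0F δ)) (ℤ₂.≈-sym (label-parity 0F)))))

  symmetrical⇒H≡⟨φ²,φτ⟩ : (C : Cycle G) → IsEuler C → Symmetrical C → HIsφ²φτ C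
  symmetrical⇒H≡⟨φ²,φτ⟩ record { ℓ = zero } euler _ = ⊥-elim (¬Fin0 (proj₁ (euler (rim 0F 0F))))
  symmetrical⇒H≡⟨φ²,φτ⟩ record { ℓ = suc n ; e = e₀ ; e-inj = e₀-injective ; α = α₀ ; joins = joins₀ } =
    H≡⟨φ²,φτ⟩ n e₀ e₀-injective α₀ joins₀

  odd-r⇒¬symmetrical : δ ≡ 1 → ∀ h → r′ ≡ h + h → (C : Cycle G) → IsEuler C → ¬ Symmetrical C
  odd-r⇒¬symmetrical _ _ _ record { ℓ = zero } euler _ = ¬Fin0 (proj₁ (euler (rim 0F 0F)))
  odd-r⇒¬symmetrical δ≡1 h r′≡h+h
    record { ℓ = suc n ; e = e₀ ; e-inj = e₀-injective ; α = α₀ ; joins = joins₀ } euler symmetrical =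
    odd-r-contradiction n e₀ e₀-injective α₀ joins₀ euler symmetrical δ≡1 h r′≡h+h

-- The cycle runs through the blocks (q , p) of Fin λ × ℤ_N: from v = p·s along a spoke to
-- v + r, then along a rim edge to v + s, where s = r + δ.  Since s is a unit modulo N, the
-- block starts p·s are distinct, so each copy of each edge is used exactly once.
module Construction (r′ δ λ′ : ℕ) (0<δ : 0 < δ) (δ<r : δ < suc r′)
  (ends₀ : Fin (suc r′ + suc r′) ⊎ (Fin (suc r′) × Fin 2) → Fin (suc r′ + suc r′) × Fin (suc r′ + suc r′))
  (ends₀-rim : ∀ i → ends₀ (inj₁ i) ≡ (i , addMod i δ))
  (ends₀-spoke : ∀ i u → ends₀ (inj₂ (i , u)) ≡ (i ↑ˡ suc r′ , suc r′ ↑ʳ i))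
  (s⁻¹ : ℕ) (s-invertible : Congruence._≈_ (suc r′ + suc r′) ((suc r′ + δ) * s⁻¹) 1)
  where

  open Circulant r′ δ λ′ 0<δ δ<r ends₀ ends₀-rim ends₀-spoke
  open Automorphisms {G}
  open ≈-Reasoning hiding (start)

  s : ℕ
  s = r + δ

  L : ℕ
  L = Λ * N * 2

  module ℤL = Congruence L
  open Dihedral (pred L) using (φ⁻¹; φ∘φ⁻¹; φ⁻¹∘φ; φ-rotation)

  walk : ℕ → ℕ
  walk zero = 0
  walk (suc zero) = r
  walk (suc (suc y)) = walk y + s

  walk-shift : ∀ y J → walk (y + J * 2) ≡ walk y + J * s
  walk-shift y zero = trans (cong walk (+-identityʳ y)) (sym (+-identityʳ (walk y)))
  walk-shift y (suc J) = trans (cong walk (trans (+-suc y (suc (J * 2))) (cong suc (+-suc y (J * 2)))))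
    (trans (cong (_+ s) (walk-shift y J)) (xy∙z≈x∙zy (walk y) (J * s) s))

  walk-periodic : ∀ y t → walk (y + t * L) ≈ walk y
  walk-periodic y t = begin
    walk (y + t * L)                 ≡⟨ cong (λ z → walk (y + z)) (sym (*-assoc t (Λ * N) 2)) ⟩
    walk (y + t * (Λ * N) * 2)       ≡⟨ walk-shift y (t * (Λ * N)) ⟩
    walk y + t * (Λ * N) * s         ≡⟨ cong (walk y +_) (regroup t Λ N s) ⟩
    walk y + t * Λ * s * N           ≈⟨ m+kn≈m (walk y) (t * Λ * s) ⟩
    walk y                           ∎
    where
    regroup : ∀ t a n s → t * (a * n) * s ≡ t * a * s * n
    regroup = solve-∀

  walk-≈ : ∀ {y y′} → y ℤL.≈ y′ → walk y ≈ walk y′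
  walk-≈ {y} {y′} (ℤL.mk y≡y′) = begin
    walk y                     ≡⟨ cong walk (m≡m%n+[m/n]*n y L) ⟩
    walk (y % L + y / L * L)   ≈⟨ walk-periodic (y % L) (y / L) ⟩
    walk (y % L)               ≡⟨ cong walk y≡y′ ⟩
    walk (y′ % L)              ≈⟨ walk-periodic (y′ % L) (y′ / L) ⟨
    walk (y′ % L + y′ / L * L) ≡⟨ cong walk (m≡m%n+[m/n]*n y′ L) ⟨
    walk y′                    ∎

  vertex : Fin L → Fin N
  vertex k = walk (toℕ k) mod N

  toℕ-vertex-φ : ∀ k → toℕ (vertex (φ k)) ≈ walk (suc (toℕ k))
  toℕ-vertex-φ k = ≈-trans (toℕ-mod _) (walk-≈ (ℤL.≈-trans (φ-rotation k) (ℤL.≡⇒≈ (+-comm (toℕ k) 1))))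

  start : Fin N → Fin N
  start = scale s

  block : Fin N → Fin N
  block = scale s⁻¹

  start∘block : ∀ v → start (block v) ≡ v
  start∘block = scale-inverse (≈-trans (≡⇒≈ (*-comm s⁻¹ s)) s-invertible)

  block∘start : ∀ v → block (start v) ≡ v
  block∘start = scale-inverse s-invertible

  compose : Fin Λ → Fin N → Fin 2 → Fin L
  compose q p b = combine (combine q p) b

  decompose : Fin L → (Fin Λ × Fin N) × Fin 2
  decompose k = remQuot {Λ} N (proj₁ (remQuot {Λ * N} 2 k)) , proj₂ (remQuot {Λ * N} 2 k)

  compose-decompose : ∀ k → uncurry (uncurry compose) (decompose k) ≡ k
  compose-decompose k =
    trans (cong (λ j → combine j (proj₂ (remQuot {Λ * N} 2 k))) (combine-remQuot {Λ} N (proj₁ (remQuot {Λ * N} 2 k))))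
          (combine-remQuot {Λ * N} 2 k)

  decompose-compose : ∀ q p b → decompose (compose q p b) ≡ ((q , p) , b)
  decompose-compose q p b =
    trans (cong (λ jb → remQuot {Λ} N (proj₁ jb) , proj₂ jb) (remQuot-combine {Λ * N} {2} (combine q p) b))
          (cong (_, b) (remQuot-combine {Λ} {N} q p))

  walk-compose : ∀ q p b c → walk (c + toℕ (compose q p b)) ≈ toℕ (start p) + walk (c + toℕ b)
  walk-compose q p b c = begin
    walk (c + toℕ (compose q p b))            ≡⟨ cong (λ y → walk (c + y)) (index-formula q p b) ⟩
    walk (c + (toℕ b + j * 2))                ≡⟨ cong walk (sym (+-assoc c (toℕ b) (j * 2))) ⟩
    walk (c + toℕ b + j * 2)                  ≡⟨ walk-shift (c + toℕ b) j ⟩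
    walk (c + toℕ b) + j * s                  ≈⟨ +-congˡ (j*s≈start) ⟩
    walk (c + toℕ b) + toℕ (start p)          ≡⟨ +-comm (walk (c + toℕ b)) (toℕ (start p)) ⟩
    toℕ (start p) + walk (c + toℕ b)          ∎
    where
    j = N * toℕ q + toℕ p
    index-formula : ∀ q p b → toℕ (compose q p b) ≡ toℕ b + (N * toℕ q + toℕ p) * 2
    index-formula q p b = trans (toℕ-combine (combine q p) b)
      (trans (cong (λ i → 2 * i + toℕ b) (toℕ-combine q p))
             (trans (+-comm (2 * (N * toℕ q + toℕ p)) (toℕ b)) (cong (toℕ b +_) (*-comm 2 (N * toℕ q + toℕ p)))))
    j*s≈start : j * s ≈ toℕ (start p)
    j*s≈start = begin
      (N * toℕ q + toℕ p) * s       ≡⟨ *-distribʳ-+ s (N * toℕ q) (toℕ p) ⟩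
      N * toℕ q * s + toℕ p * s     ≡⟨ +-comm (N * toℕ q * s) (toℕ p * s) ⟩
      toℕ p * s + N * toℕ q * s     ≡⟨ cong (toℕ p * s +_) (trans (*-assoc N (toℕ q) s) (*-comm N (toℕ q * s))) ⟩
      toℕ p * s + toℕ q * s * N     ≈⟨ m+kn≈m (toℕ p * s) (toℕ q * s) ⟩
      toℕ p * s                     ≈⟨ toℕ-scale s p ⟨
      toℕ (start p)                 ∎

  toℕ-vertex-compose : ∀ q p b → toℕ (vertex (compose q p b)) ≈ toℕ (start p) + walk (toℕ b)
  toℕ-vertex-compose q p b = ≈-trans (toℕ-mod _) (walk-compose q p b 0)

  toℕ-vertex-φ-compose : ∀ q p b → toℕ (vertex (φ (compose q p b))) ≈ toℕ (start p) + walk (suc (toℕ b))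
  toℕ-vertex-φ-compose q p b = ≈-trans (toℕ-vertex-φ (compose q p b)) (walk-compose q p b 1)

  spoke-of : Fin r ⊎ Fin r → Fin r × Fin 2
  spoke-of (inj₁ i) = i , 0F
  spoke-of (inj₂ i) = i , 1F

  spoke-origin : Fin r × Fin 2 → Fin N
  spoke-origin (i , 0F) = i ↑ˡ r
  spoke-origin (i , 1F) = r ↑ʳ i

  leaving : Fin N → Fin 2 → Fin N ⊎ (Fin r × Fin 2)
  leaving v 0F = inj₂ (spoke-of (splitAt r v))
  leaving v 1F = inj₁ (translate r v)

  leaving⁻¹ : Fin N ⊎ (Fin r × Fin 2) → Fin N × Fin 2
  leaving⁻¹ (inj₂ iu) = spoke-origin iu , 0F
  leaving⁻¹ (inj₁ m) = translate r m , 1F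

  translate-r-involutive : ∀ v → translate r (translate r v) ≡ v
  translate-r-involutive v = toℕ-≈-injective (begin
    toℕ (translate r (translate r v))  ≈⟨ toℕ-translate r (translate r v) ⟩
    toℕ (translate r v) + r            ≈⟨ +-congʳ (toℕ-translate r v) ⟩
    toℕ v + r + r                      ≡⟨ +-assoc (toℕ v) r r ⟩
    toℕ v + N                          ≈⟨ m+n≈m (toℕ v) ⟩
    toℕ v                              ∎)

  spoke-of-origin : ∀ iu → spoke-of (splitAt r (spoke-origin iu)) ≡ iu
  spoke-of-origin (i , 0F) = cong spoke-of (splitAt-↑ˡ r i r)
  spoke-of-origin (i , 1F) = cong spoke-of (splitAt-↑ʳ r r i)

  origin-of-spoke : ∀ v → spoke-origin (spoke-of (splitAt r v)) ≡ v
  origin-of-spoke v = trans (origin≡join (splitAt r v)) (join-splitAt r r v)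
    where
    origin≡join : ∀ x → spoke-origin (spoke-of x) ≡ join r r x
    origin≡join (inj₁ _) = refl
    origin≡join (inj₂ _) = refl

  leaving∘leaving⁻¹ : ∀ x → uncurry leaving (leaving⁻¹ x) ≡ x
  leaving∘leaving⁻¹ (inj₂ iu) = cong inj₂ (spoke-of-origin iu)
  leaving∘leaving⁻¹ (inj₁ m) = cong inj₁ (translate-r-involutive m)

  leaving⁻¹∘leaving : ∀ v b → leaving⁻¹ (leaving v b) ≡ (v , b)
  leaving⁻¹∘leaving v 0F = cong (_, 0F) (origin-of-spoke v)
  leaving⁻¹∘leaving v 1F = cong (_, 1F) (translate-r-involutive v)

  edge-at : (Fin Λ × Fin N) × Fin 2 → Edge
  edge-at ((q , p) , b) = leaving (start p) b , q

  edge : Fin L → Edge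
  edge = edge-at ∘ decompose

  index : Edge → Fin L
  index (x , q) = compose q (block (proj₁ (leaving⁻¹ x))) (proj₂ (leaving⁻¹ x))

  edge-index : ∀ y → edge (index y) ≡ y
  edge-index (x , q) = trans (cong edge-at (decompose-compose q (block v) b))
    (cong (_, q) (trans (cong (λ v′ → leaving v′ b) (start∘block v)) (leaving∘leaving⁻¹ x)))
    where
    v = proj₁ (leaving⁻¹ x)
    b = proj₂ (leaving⁻¹ x)

  index-edge : ∀ k → index (edge k) ≡ k
  index-edge k = trans (index-edge-at (decompose k)) (compose-decompose k)
    where
    index-edge-at : ∀ t → index (edge-at t) ≡ uncurry (uncurry compose) t
    index-edge-at ((q , p) , b) =
      trans (cong (λ vb → compose q (block (proj₁ vb)) (proj₂ vb)) (leaving⁻¹∘leaving (start p) b))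
            (cong (λ p′ → compose q p′ b) (block∘start p))

  spoke-joins : ∀ v {u w} q → toℕ u ≈ toℕ v → toℕ w ≈ toℕ v + r → Joins G (leaving v 0F , q) u w
  spoke-joins v {u} {w} q u≈v w≈v+r with splitAt r v in split-v
  ... | inj₁ i = inj₁ (trans (ends₀-spoke i 0F) (cong₂ _,_ (sym u≡) (sym w≡)))
    where
    v≡ : v ≡ i ↑ˡ r
    v≡ = trans (sym (join-splitAt r r v)) (cong (join r r) split-v)
    u≡ : u ≡ i ↑ˡ r
    u≡ = trans (toℕ-≈-injective u≈v) v≡
    w≡ : w ≡ r ↑ʳ i
    w≡ = toℕ-≈-injective (begin
      toℕ w             ≈⟨ w≈v+r ⟩
      toℕ v + r         ≡⟨ cong (λ v′ → toℕ v′ + r) v≡ ⟩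
      toℕ (i ↑ˡ r) + r  ≡⟨ cong (_+ r) (toℕ-↑ˡ i r) ⟩
      toℕ i + r         ≡⟨ +-comm (toℕ i) r ⟩
      r + toℕ i         ≡⟨ toℕ-↑ʳ r i ⟨
      toℕ (r ↑ʳ i)      ∎)
  ... | inj₂ i = inj₂ (trans (ends₀-spoke i 1F) (cong₂ _,_ (sym w≡) (sym u≡)))
    where
    v≡ : v ≡ r ↑ʳ i
    v≡ = trans (sym (join-splitAt r r v)) (cong (join r r) split-v)
    u≡ : u ≡ r ↑ʳ i
    u≡ = trans (toℕ-≈-injective u≈v) v≡
    w≡ : w ≡ i ↑ˡ r
    w≡ = toℕ-≈-injective (begin
      toℕ w             ≈⟨ w≈v+r ⟩
      toℕ v + r         ≡⟨ cong (λ v′ → toℕ v′ + r) v≡ ⟩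
      toℕ (r ↑ʳ i) + r  ≡⟨ cong (_+ r) (toℕ-↑ʳ r i) ⟩
      r + toℕ i + r     ≡⟨ xy∙z≈y∙xz r (toℕ i) r ⟩
      toℕ i + N         ≈⟨ m+n≈m (toℕ i) ⟩
      toℕ i             ≡⟨ toℕ-↑ˡ i r ⟨
      toℕ (i ↑ˡ r)      ∎)

  rim-joins : ∀ v {u w} q → toℕ u ≈ toℕ v + r → toℕ w ≈ toℕ v + s → Joins G (leaving v 1F , q) u w
  rim-joins v {u} {w} q u≈v+r w≈v+s = inj₁ (trans (ends₀-rim (translate r v)) (cong₂ _,_ (sym u≡) (sym w≡)))
    where
    u≡ : u ≡ translate r v
    u≡ = toℕ-≈-injective (≈-trans u≈v+r (≈-sym (toℕ-translate r v)))
    w≡ : w ≡ addMod (translate r v) δ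
    w≡ = toℕ-≈-injective (begin
      toℕ w                        ≈⟨ w≈v+s ⟩
      toℕ v + (r + δ)              ≡⟨ +-assoc (toℕ v) r δ ⟨
      toℕ v + r + δ                ≈⟨ +-congʳ (toℕ-translate r v) ⟨
      toℕ (translate r v) + δ      ≈⟨ toℕ-addMod (translate r v) δ ⟨
      toℕ (addMod (translate r v) δ) ∎)

  edge-joins-at : ∀ q p b → Joins G (edge (compose q p b)) (vertex (compose q p b)) (vertex (φ (compose q p b)))
  edge-joins-at q p b = subst (λ x → Joins G x (vertex (compose q p b)) (vertex (φ (compose q p b))))
                              (sym (cong edge-at (decompose-compose q p b))) (leaving-joins b)
    where
    leaving-joins : ∀ b → Joins G (leaving (start p) b , q) (vertex (compose q p b)) (vertex (φ (compose q p b)))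
    leaving-joins 0F = spoke-joins (start p) q (≈-trans (toℕ-vertex-compose q p 0F) (≡⇒≈ (+-identityʳ _)))
                                               (toℕ-vertex-φ-compose q p 0F)
    leaving-joins 1F = rim-joins (start p) q (toℕ-vertex-compose q p 1F) (toℕ-vertex-φ-compose q p 1F)

  edge-joins : ∀ k → Joins G (edge k) (vertex k) (vertex (φ k))
  edge-joins k = subst (λ k′ → Joins G (edge k′) (vertex k′) (vertex (φ k′))) (compose-decompose k)
    (edge-joins-at (proj₁ (proj₁ (decompose k))) (proj₂ (proj₁ (decompose k))) (proj₂ (decompose k)))

  cycle : Cycle G
  cycle = record
    { ℓ = L ; e = edge ; α = vertex ; joins = edge-joins
    ; e-inj = λ i j eᵢ≡eⱼ → trans (sym (index-edge i)) (trans (cong index eᵢ≡eⱼ) (index-edge j)) }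

  euler : IsEuler cycle
  euler y = index y , edge-index y

  translate-s-shifts : ∀ k → translate s (vertex k) ≡ vertex (φ (φ k))
  translate-s-shifts k = toℕ-≈-injective (begin
    toℕ (translate s (vertex k))  ≈⟨ toℕ-translate s (vertex k) ⟩
    toℕ (vertex k) + s            ≈⟨ +-congʳ (toℕ-mod (walk (toℕ k))) ⟩
    walk (2 + toℕ k)              ≈⟨ walk-≈ two-steps ⟩
    walk (toℕ (φ (φ k)))          ≈⟨ toℕ-mod _ ⟨
    toℕ (vertex (φ (φ k)))        ∎)
    where
    two-steps : 2 + toℕ k ℤL.≈ toℕ (φ (φ k))
    two-steps = ℤL.≈-sym (ℤL.≈-trans (φ-rotation (φ k))
      (ℤL.≈-trans (ℤL.+-congʳ (φ-rotation k)) (ℤL.≡⇒≈ (trans (+-assoc (toℕ k) 1 1) (+-comm (toℕ k) 2)))))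

  symmetrical : Symmetrical cycle
  symmetrical = comp (gen (inj₁ λ _ → refl)) (gen (inj₁ λ _ → refl))
              , realizes cycle euler (φ ∘ φ) (φ⁻¹ ∘ φ⁻¹) φ²∘φ⁻² φ⁻²∘φ²
                  (translate s) (translate (- s)) (translate-inverseʳ s) (translate-inverseˡ s)
                  (λ k → inj₁ (translate-s-shifts k , translate-s-shifts (φ k)))
    where
    φ²∘φ⁻² : (φ ∘ φ) ∘ (φ⁻¹ ∘ φ⁻¹) ≗ id
    φ²∘φ⁻² k = trans (cong φ (φ∘φ⁻¹ (φ⁻¹ k))) (φ∘φ⁻¹ k)
    φ⁻²∘φ² : (φ⁻¹ ∘ φ⁻¹) ∘ (φ ∘ φ) ≗ id
    φ⁻²∘φ² k = trans (cong φ⁻¹ (φ⁻¹∘φ (φ k))) (φ⁻¹∘φ k)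

  symmetrical-Euler-cycle : ∃[ C ] (IsEuler C × Symmetrical C)
  symmetrical-Euler-cycle = cycle , euler , symmetrical

A-step-invertible : ∀ r′ t → suc r′ ≡ t * 2 →
  let open Congruence (suc r′ + suc r′) in (suc r′ + 1) * (suc r′ + 1) ≈ 1
A-step-invertible r′ t r≡2t = let open Congruence (suc r′ + suc r′) in
  ≈-trans (≡⇒≈ (subst (λ R → (R + 1) * (R + 1) ≡ 1 + (t + 1) * (R + R)) (sym r≡2t) (square t))) (m+kn≈m 1 (t + 1))
  where
  square : ∀ t → (t * 2 + 1) * (t * 2 + 1) ≡ 1 + (t + 1) * (t * 2 + t * 2)
  square = solve-∀

B-step-invertible : ∀ r′ h → r′ ≡ h + h →
  let open Congruence (suc r′ + suc r′) in (suc r′ + 2) * (2 * h * h + 6 * h + 3) ≈ 1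
B-step-invertible r′ h r′≡2h = let open Congruence (suc r′ + suc r′) in
  ≈-trans (≡⇒≈ (subst (λ R → (suc R + 2) * (2 * h * h + 6 * h + 3) ≡ 1 + (h + 2) * (h + 2) * (suc R + suc R))
                      (sym r′≡2h) (product h)))
          (m+kn≈m 1 ((h + 2) * (h + 2)))
  where
  product : ∀ h → (suc (h + h) + 2) * (2 * h * h + 6 * h + 3) ≡ 1 + (h + 2) * (h + 2) * (suc (h + h) + suc (h + h))
  product = solve-∀

A-symmetrical-Euler-cycles : ∀ (r λ′ : ℕ) → 2 ≤ r → 1 ≤ λ′ →
  ((∃[ C ] (IsEuler C × Symmetrical {A r ^⁽ λ′ ⁾} C)) → 2 ∣ r)
  × (2 ∣ r → ∃[ C ] (IsEuler C × Symmetrical {A r ^⁽ λ′ ⁾} C))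
  × (∀ (C : Cycle (A r ^⁽ λ′ ⁾)) → IsEuler C → Symmetrical C → HIsφ²φτ C)
A-symmetrical-Euler-cycles (suc r′) (suc λ′) 2≤r (s≤s z≤n) = only-if-even , if-even , symmetrical⇒H≡⟨φ²,φτ⟩
  where
  open SymmetricalCycle r′ 1 λ′ (s≤s z≤n) 2≤r (ends (A (suc r′))) (λ _ → refl) (λ _ _ → refl)
    using (symmetrical⇒H≡⟨φ²,φτ⟩; odd-r⇒¬symmetrical)

  only-if-even : ∃[ C ] (IsEuler C × Symmetrical {A (suc r′) ^⁽ suc λ′ ⁾} C) → 2 ∣ suc r′
  only-if-even (C , euler , symmetrical) with even-or-odd r′
  ... | h , inj₁ r′≡h+h = ⊥-elim (odd-r⇒¬symmetrical refl h r′≡h+h C euler symmetrical)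
  ... | h , inj₂ r′≡1+h+h = divides (suc h) (trans (cong suc r′≡1+h+h) (2+h+h≡[1+h]*2 h))

  if-even : 2 ∣ suc r′ → ∃[ C ] (IsEuler C × Symmetrical {A (suc r′) ^⁽ suc λ′ ⁾} C)
  if-even (divides t r≡t*2) = Construction.symmetrical-Euler-cycle r′ 1 λ′ (s≤s z≤n) 2≤r (ends (A (suc r′)))
    (λ _ → refl) (λ _ _ → refl) (suc r′ + 1) (A-step-invertible r′ t r≡t*2)

B-symmetrical-Euler-cycles : ∀ (r λ′ : ℕ) → 3 ≤ r → ¬ (2 ∣ r) → 1 ≤ λ′ →
  (∃[ C ] (IsEuler C × Symmetrical {B r ^⁽ λ′ ⁾} C))
  × (∀ (C : Cycle (B r ^⁽ λ′ ⁾)) → IsEuler C → Symmetrical C → HIsφ²φτ C)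
B-symmetrical-Euler-cycles (suc r′) (suc λ′) 3≤r r-odd (s≤s z≤n) = exists , symmetrical⇒H≡⟨φ²,φτ⟩
  where
  open SymmetricalCycle r′ 2 λ′ (s≤s z≤n) 3≤r (ends (B (suc r′))) (λ _ → refl) (λ _ _ → refl)
    using (symmetrical⇒H≡⟨φ²,φτ⟩)

  exists : ∃[ C ] (IsEuler C × Symmetrical {B (suc r′) ^⁽ suc λ′ ⁾} C)
  exists with even-or-odd r′
  ... | h , inj₂ r′≡1+h+h = ⊥-elim (r-odd (divides (suc h) (trans (cong suc r′≡1+h+h) (2+h+h≡[1+h]*2 h))))
  ... | h , inj₁ r′≡h+h = Construction.symmetrical-Euler-cycle r′ 2 λ′ (s≤s z≤n) 3≤r (ends (B (suc r′)))
    (λ _ → refl) (λ _ _ → refl) (2 * h * h + 6 * h + 3) (B-step-invertible r′ h r′≡h+h)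

lemma7p3 :
    (∀ (r λ′ : ℕ) → 2 ≤ r → 1 ≤ λ′ →
      ((∃[ C ] (IsEuler C × Symmetrical {A r ^⁽ λ′ ⁾} C)) → 2 ∣ r)
      × (2 ∣ r → ∃[ C ] (IsEuler C × Symmetrical {A r ^⁽ λ′ ⁾} C))
      × (∀ (C : Cycle (A r ^⁽ λ′ ⁾)) → IsEuler C → Symmetrical C → HIsφ²φτ C))
    ×
    (∀ (r λ′ : ℕ) → 3 ≤ r → ¬ (2 ∣ r) → 1 ≤ λ′ →
      (∃[ C ] (IsEuler C × Symmetrical {B r ^⁽ λ′ ⁾} C))
      × (∀ (C : Cycle (B r ^⁽ λ′ ⁾)) → IsEuler C → Symmetrical C → HIsφ²φτ C))
lemma7p3 = A-symmetrical-Euler-cycles , B-symmetrical-Euler-cycles
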